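{- If the $p$-dimensional cubical category $\mathsf{Rel}$ has products stable under face maps and degeneracies, then for every $n\in\mathbb{N}$ there is a choice of binary products $(\times_n,\mathsf{fst}_n,\mathsf{snd}_n)$ in the category $|\mathsf{Rel}|^n\to\mathsf{Rel}$.
   Context: Fix a finitely complete, locally small category $\mathcal{C}$ and $p\in\mathbb{N}\cup\{\infty\}$; all categories, functors, natural transformations and products are internal to $\mathcal{C}$ ($\mathcal{X}_0,\mathcal{X}_1$ denote objects of objects/morphisms). The category $\square_p$ has objects the levels $l=\{0,\dots,l-1\}$, $l\le p$, and is generated by the face maps $\mathbf{f}_\star(l,k):l+1\to l$ ($\star\in\{\top,\bot\}$, $k\le l<p$; as a function $l+1\to l+\{\top,\bot\}$ it fixes $i<k$, sends $k\mapsto\star$, and $i\mapsto i-1$ for $i>k$) and the degeneracies $\mathbf{d}(l,k):l\to l+1$ ($k\le l<p$; fixes $i<k$, $i\mapsto i+1$ for $i\ge k$), with Kleisli composition in which $\top,\bot$ propagate. A $p$-dimensional cubical category is a functor $\square_p\to\mathsf{Cat}(\mathcal{C})$; $|\mathcal{X}|$ is its levelwise discrete version and $\mathcal{X}^n$ its levelwise $n$-fold power. A cubical functor $\mathcal{F}:\mathcal{X}\to\mathcal{Y}$ is a family of functors $\mathcal{F}(l):\mathcal{X}(l)\to\mathcal{Y}(l)$; it is face map-preserving if $\mathcal{Y}(h)\circ\mathcal{F}(l_1)=\mathcal{F}(l_2)\circ\mathcal{X}(h)$ for face maps $h:l_1\to l_2$, degeneracy-preserving if for degeneracies $h$ there are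 chosen natural isomorphisms $\varepsilon_\mathcal{F}(h):\mathcal{Y}(h)\circ\mathcal{F}(l_1)\to\mathcal{F}(l_2)\circ\mathcal{X}(h)$. A cubical natural transformation $\eta:\mathcal{F}\to\mathcal{G}$ is a family $\eta(l):\mathcal{F}(l)\to\mathcal{G}(l)$; face map-preserving: $\mathcal{Y}(h)(\eta(l_1)X)=\eta(l_2)(\mathcal{X}(h)X)$ for face maps $h$; degeneracy-preserving: $\eta(l_2)(\mathcal{X}(h)X)\circ\varepsilon_\mathcal{F}(h)X=\varepsilon_\mathcal{G}(h)X\circ\mathcal{Y}(h)(\eta(l_1)X)$ for degeneracies $h$. $\mathsf{Rel}$ is a $p$-dimensional cubical category with a class $M=\sum_{l\le p}M(l)$ of good isomorphisms (morphisms $J\to\mathsf{Rel}(l)_1$ of $\mathcal{C}$ that are isomorphisms in $\mathsf{Rel}(l)$; containing identities, closed under composition, inverses and reindexing). The category $|\mathsf{Rel}|^n\to\mathsf{Rel}$ has objects triples $(\mathcal{F},\varepsilon_\mathcal{F},\upsilon_\mathcal{F})$ with $\mathcal{F}:|\mathsf{Rel}|^n\to\mathsf{Rel}$ a face map-preserving cubical functor, $\varepsilon_\mathcal{F}$ witnessing degeneracy-preservation with $\varepsilon_\mathcal{F}(h)\in M(l_2)$ for each degeneracy $h:l_1\to l_2$, and $\upsilon_\mathcal{F}$ sending each isomorphism $f:\mathsf{Rel}(l)_0^m\to\mathsf{Rel}(l)_1^n$ with all components $\pi_k\circ f$ in $M(l)$ to an isomorphism $\upsilon_\mathcal{F}(f):\mathsf{Rel}(l)_0^m\to\mathsf{Rel}(l)_1$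 in $M(l)$, compatibly with source, target, identities, composition and reindexing; morphisms are face map- and degeneracy-preserving cubical natural transformations. $\mathsf{Rel}$ has products if it comes with chosen products $(\times_l,\mathsf{fst}_l,\mathsf{snd}_l)$ in each $\mathsf{Rel}(l)$, $l\le p$, and each $M(l)$ is closed under products. They are stable under face maps if for each face map $h:l_1\to l_2$ and objects $A,B$ of $\mathsf{Rel}(l_1)$: $\mathsf{Rel}(h)(A\times_{l_1}B)=\mathsf{Rel}(h)A\times_{l_2}\mathsf{Rel}(h)B$, $\mathsf{Rel}(h)(\mathsf{fst}_{l_1}[A,B])=\mathsf{fst}_{l_2}[\mathsf{Rel}(h)A,\mathsf{Rel}(h)B]$, $\mathsf{Rel}(h)(\mathsf{snd}_{l_1}[A,B])=\mathsf{snd}_{l_2}[\mathsf{Rel}(h)A,\mathsf{Rel}(h)B]$. They are stable under degeneracies if for each degeneracy $h:l_1\to l_2$ the first equality holds up to an isomorphism $\varepsilon(h,A,B):\mathsf{Rel}(h)(A\times_{l_1}B)\to\mathsf{Rel}(h)A\times_{l_2}\mathsf{Rel}(h)B$ in $M(l_2)$ such that $\mathsf{fst}_{l_2}[\mathsf{Rel}(h)A,\mathsf{Rel}(h)B]\circ\varepsilon(h,A,B)=\mathsf{Rel}(h)(\mathsf{fst}_{l_1}[A,B])$ and $\mathsf{snd}_{l_2}[\mathsf{Rel}(h)A,\mathsf{Rel}(h)B]\circ\varepsilon(h,A,B)=\mathsf{Rel}(h)(\mathsf{snd}_{l_1}[A,B])$. -}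

module Defs where

open import Level using (Level; _⊔_) renaming (suc to lsuc)
open import Data.Nat using (ℕ; zero; suc; _≤_)
open import Data.Nat.Properties using (<⇒≤)
open import Data.Fin using (Fin; punchIn; punchOut) renaming (zero to fzero; suc to fsuc; _≟_ to _≟F_)
open import Data.Bool using (Bool)
open import Data.Sum using (_⊎_; inj₁; inj₂)
open import Data.Unit using (⊤; tt)
open import Data.Product using (_×_)
open import Relation.Nullary using (yes; no)
open import Relation.Binary.PropositionalEquality using (_≡_; trans; sym)

record FinCompleteCategory (o ℓ : Level) : Set (lsuc (o ⊔ ℓ)) where
  infixr 9 _∘_
  infixr 7 _×ₒ_
  field
    Obj : Set o
    Hom : Obj → Obj → Set ℓ
    id  : ∀ {A} → Hom A A
    _∘_ : ∀ {A B C} → Hom B C → Hom A B → Hom A C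
    idˡ : ∀ {A B} (f : Hom A B) → id ∘ f ≡ f
    idʳ : ∀ {A B} (f : Hom A B) → f ∘ id ≡ f
    assoc : ∀ {A B C D} (h : Hom C D) (g : Hom B C) (f : Hom A B) →
            (h ∘ g) ∘ f ≡ h ∘ (g ∘ f)
    𝟙 : Obj
    ! : ∀ {A} → Hom A 𝟙
    !-unique : ∀ {A} (f : Hom A 𝟙) → f ≡ !
    _×ₒ_ : Obj → Obj → Obj
    π₁ : ∀ {A B} → Hom (A ×ₒ B) A
    π₂ : ∀ {A B} → Hom (A ×ₒ B) B
    ⟨_,_⟩ : ∀ {J A B} → Hom J A → Hom J B → Hom J (A ×ₒ B)
    π₁∘⟨⟩ : ∀ {J A B} (f : Hom J A) (g : Hom J B) → π₁ ∘ ⟨ f , g ⟩ ≡ f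
    π₂∘⟨⟩ : ∀ {J A B} (f : Hom J A) (g : Hom J B) → π₂ ∘ ⟨ f , g ⟩ ≡ g
    ⟨⟩-unique : ∀ {J A B} (h : Hom J (A ×ₒ B)) (f : Hom J A) (g : Hom J B) →
                π₁ ∘ h ≡ f → π₂ ∘ h ≡ g → h ≡ ⟨ f , g ⟩
    PB : ∀ {A B C} → Hom A C → Hom B C → Obj
    p₁ : ∀ {A B C} {f : Hom A C} {g : Hom B C} → Hom (PB f g) A
    p₂ : ∀ {A B C} {f : Hom A C} {g : Hom B C} → Hom (PB f g) B
    pcomm : ∀ {A B C} {f : Hom A C} {g : Hom B C} → f ∘ p₁ {f = f} {g} ≡ g ∘ p₂ {f = f} {g}
    pair : ∀ {J A B C} {f : Hom A C} {g : Hom B C} (a : Hom J A) (b : Hom J B) →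
           f ∘ a ≡ g ∘ b → Hom J (PB f g)
    p₁∘pair : ∀ {J A B C} {f : Hom A C} {g : Hom B C} (a : Hom J A) (b : Hom J B)
              (q : f ∘ a ≡ g ∘ b) → p₁ ∘ pair a b q ≡ a
    p₂∘pair : ∀ {J A B C} {f : Hom A C} {g : Hom B C} (a : Hom J A) (b : Hom J B)
              (q : f ∘ a ≡ g ∘ b) → p₂ ∘ pair a b q ≡ b
    pair-unique : ∀ {J A B C} {f : Hom A C} {g : Hom B C} (h : Hom J (PB f g))
                  (a : Hom J A) (b : Hom J B) (q : f ∘ a ≡ g ∘ b) →
                  p₁ ∘ h ≡ a → p₂ ∘ h ≡ b → h ≡ pair a b q

-- Dimensions p ∈ ℕ ∪ {∞}, levels l ≤ p, the generators of □_p and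
-- their interpretation as functions l₁ → l₂ + {⊤,⊥}
-- (Bool encodes {⊤,⊥}: true = ⊤, false = ⊥).

data ℕ∞ : Set where
  fin : ℕ → ℕ∞
  ∞   : ℕ∞

_≤∞_ : ℕ → ℕ∞ → Set
l ≤∞ fin n = l ≤ n
l ≤∞ ∞     = ⊤

≤∞-pred : ∀ {l p} → suc l ≤∞ p → l ≤∞ p
≤∞-pred {p = fin n} b = <⇒≤ b
≤∞-pred {p = ∞}     b = tt

record Lvl (p : ℕ∞) : Set where
  constructor mkL
  field
    lv : ℕ
    .bound : lv ≤∞ p
open Lvl public

-- generators: face maps f_⋆(l,k) : l+1 → l and degeneracies d(l,k) : l → l+1,
-- k ≤ l < p   (k ranges over Fin (suc l), i.e. k ≤ l; suc l ≤ p, i.e. l < p)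
data Gen {p : ℕ∞} : Lvl p → Lvl p → Set where
  face  : (⋆ : Bool) (l : ℕ) (k : Fin (suc l)) .(b : suc l ≤∞ p) →
          Gen (mkL (suc l) b) (mkL l (≤∞-pred b))
  degen : (l : ℕ) (k : Fin (suc l)) .(b : suc l ≤∞ p) →
          Gen (mkL l (≤∞-pred b)) (mkL (suc l) b)

⟦_⟧g : ∀ {p} {a b : Lvl p} → Gen a b → Fin (lv a) → Fin (lv b) ⊎ Bool
⟦ face ⋆ l k b ⟧g i with k ≟F i
... | yes _   = inj₂ ⋆
... | no  k≢i = inj₁ (punchOut k≢i)
⟦ degen l k b ⟧g i = inj₁ (punchIn k i)

-- words in the generators (morphisms of the free category), composed
-- right-to-left; interpreted by Kleisli composition with ⊤,⊥ propagating
data Word {p : ℕ∞} : Lvl p → Lvl p → Set where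
  []  : ∀ {a} → Word a a
  _∷_ : ∀ {a b c} → Gen b c → Word a b → Word a c

⟦_⟧w : ∀ {p} {a b : Lvl p} → Word a b → Fin (lv a) → Fin (lv b) ⊎ Bool
⟦ [] ⟧w i = inj₁ i
⟦ g ∷ w ⟧w i with ⟦ w ⟧w i
... | inj₁ j = ⟦ g ⟧g j
... | inj₂ s = inj₂ s

module Internal {o ℓ : Level} (𝒞 : FinCompleteCategory o ℓ) where
  open FinCompleteCategory 𝒞

  _^_ : Obj → ℕ → Obj
  A ^ zero  = 𝟙
  A ^ suc n = A ×ₒ (A ^ n)

  proj : ∀ {A n} → Fin n → Hom (A ^ n) A
  proj fzero    = π₁
  proj (fsuc k) = proj k ∘ π₂

  tuple : ∀ {J A} n → (Fin n → Hom J A) → Hom J (A ^ n)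
  tuple zero    fs = !
  tuple (suc n) fs = ⟨ fs fzero , tuple n (λ k → fs (fsuc k)) ⟩

  pow : ∀ {A B} n → Hom A B → Hom (A ^ n) (B ^ n)
  pow n f = tuple n (λ k → f ∘ proj k)

  _×₁_ : ∀ {A A' B B'} → Hom A A' → Hom B B' → Hom (A ×ₒ B) (A' ×ₒ B')
  f ×₁ g = ⟨ f ∘ π₁ , g ∘ π₂ ⟩

  -- internal categories; composable pairs (g , f) live in PB src tgt
  -- (src g = tgt f), composite  comp ∘ pair g f q  is "g ∘ f".
  -- Laws are stated for generalized elements J → Ob₁; whenever an
  -- equation mentions a composite whose composability proof is derivable,
  -- it is quantified over that proof.
  record ICat : Set (o ⊔ ℓ) where
    field
      Ob₀ Ob₁ : Obj
      src tgt : Hom Ob₁ Ob₀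
      idn : Hom Ob₀ Ob₁
      comp : Hom (PB src tgt) Ob₁
      src-idn : src ∘ idn ≡ id
      tgt-idn : tgt ∘ idn ≡ id
      src-comp : src ∘ comp ≡ src ∘ p₂
      tgt-comp : tgt ∘ comp ≡ tgt ∘ p₁
      comp-idˡ : ∀ {J} (f : Hom J Ob₁) (q : src ∘ (idn ∘ (tgt ∘ f)) ≡ tgt ∘ f) →
                 comp ∘ pair (idn ∘ (tgt ∘ f)) f q ≡ f
      comp-idʳ : ∀ {J} (f : Hom J Ob₁) (q : src ∘ f ≡ tgt ∘ (idn ∘ (src ∘ f))) →
                 comp ∘ pair f (idn ∘ (src ∘ f)) q ≡ f
      comp-assoc : ∀ {J} (h g f : Hom J Ob₁) (q₁ : src ∘ h ≡ tgt ∘ g) (q₂ : src ∘ g ≡ tgt ∘ f)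
                   (q₃ : src ∘ (comp ∘ pair h g q₁) ≡ tgt ∘ f)
                   (q₄ : src ∘ h ≡ tgt ∘ (comp ∘ pair g f q₂)) →
                   comp ∘ pair (comp ∘ pair h g q₁) f q₃ ≡ comp ∘ pair h (comp ∘ pair g f q₂) q₄
  open ICat public

  record IsIFunctor (X Y : ICat) (F₀ : Hom (Ob₀ X) (Ob₀ Y)) (F₁ : Hom (Ob₁ X) (Ob₁ Y)) : Set (o ⊔ ℓ) where
    field
      F-src : src Y ∘ F₁ ≡ F₀ ∘ src X
      F-tgt : tgt Y ∘ F₁ ≡ F₀ ∘ tgt X
      F-idn : F₁ ∘ idn X ≡ idn Y ∘ F₀
      F-comp : ∀ {J} (g f : Hom J (Ob₁ X)) (q : src X ∘ g ≡ tgt X ∘ f)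
               (q' : src Y ∘ (F₁ ∘ g) ≡ tgt Y ∘ (F₁ ∘ f)) →
               F₁ ∘ (comp X ∘ pair g f q) ≡ comp Y ∘ pair (F₁ ∘ g) (F₁ ∘ f) q'

  record IFunctor (X Y : ICat) : Set (o ⊔ ℓ) where
    field
      F₀ : Hom (Ob₀ X) (Ob₀ Y)
      F₁ : Hom (Ob₁ X) (Ob₁ Y)
      isIFunctor : IsIFunctor X Y F₀ F₁
  open IFunctor public

  record INatTrans (X Y : ICat) (F₀ : Hom (Ob₀ X) (Ob₀ Y)) (F₁ : Hom (Ob₁ X) (Ob₁ Y))
                   (G₀ : Hom (Ob₀ X) (Ob₀ Y)) (G₁ : Hom (Ob₁ X) (Ob₁ Y)) : Set (o ⊔ ℓ) where
    field
      η : Hom (Ob₀ X) (Ob₁ Y)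
      η-src : src Y ∘ η ≡ F₀
      η-tgt : tgt Y ∘ η ≡ G₀
      η-natural : (q : src Y ∘ (η ∘ tgt X) ≡ tgt Y ∘ F₁) (q' : src Y ∘ G₁ ≡ tgt Y ∘ (η ∘ src X)) →
                  comp Y ∘ pair (η ∘ tgt X) F₁ q ≡ comp Y ∘ pair G₁ (η ∘ src X) q'
  open INatTrans public

  record IsInverse (X : ICat) {J : Obj} (g f : Hom J (Ob₁ X)) : Set ℓ where
    field
      inv-src : src X ∘ g ≡ tgt X ∘ f
      inv-tgt : tgt X ∘ g ≡ src X ∘ f
      inv-left  : (q : src X ∘ g ≡ tgt X ∘ f) → comp X ∘ pair g f q ≡ idn X ∘ (src X ∘ f)
      inv-right : (q : src X ∘ f ≡ tgt X ∘ g) → comp X ∘ pair f g q ≡ idn X ∘ (tgt X ∘ f)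

  record IsIso (X : ICat) {J : Obj} (f : Hom J (Ob₁ X)) : Set ℓ where
    field
      inverse : Hom J (Ob₁ X)
      isInverse : IsInverse X inverse f

  -- p-dimensional cubical categories: functors □_p → Cat(𝒞), given on
  -- generators, extended to words by composition, and required to send
  -- words with the same interpretation to the same internal functor.
  module _ {p : ℕ∞} (obj : Lvl p → ICat) (act : ∀ {a b} → Gen a b → IFunctor (obj a) (obj b)) where
    actW₀ : ∀ {a b} → Word a b → Hom (Ob₀ (obj a)) (Ob₀ (obj b))
    actW₀ []      = id
    actW₀ (g ∷ w) = F₀ (act g) ∘ actW₀ w
    actW₁ : ∀ {a b} → Word a b → Hom (Ob₁ (obj a)) (Ob₁ (obj b))
    actW₁ []      = id
    actW₁ (g ∷ w) = F₁ (act g) ∘ actW₁ w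

  record CubicalCat (p : ℕ∞) : Set (o ⊔ ℓ) where
    field
      obj : Lvl p → ICat
      act : ∀ {a b} → Gen a b → IFunctor (obj a) (obj b)
      act-resp : ∀ {a b} (w w' : Word a b) → (∀ i → ⟦ w ⟧w i ≡ ⟦ w' ⟧w i) →
                 (actW₀ obj act w ≡ actW₀ obj act w') × (actW₁ obj act w ≡ actW₁ obj act w')
  open CubicalCat public

  record GoodIsos {p : ℕ∞} (Rel : CubicalCat p) (m : Level) : Set (o ⊔ ℓ ⊔ lsuc m) where
    field
      M : (l : Lvl p) {J : Obj} → Hom J (Ob₁ (obj Rel l)) → Set m
      M-iso : ∀ l {J} (f : Hom J (Ob₁ (obj Rel l))) → M l f → IsIso (obj Rel l) f
      M-id : ∀ l {J} (a : Hom J (Ob₀ (obj Rel l))) → M l (idn (obj Rel l) ∘ a)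
      M-comp : ∀ l {J} (g f : Hom J (Ob₁ (obj Rel l))) (q : src (obj Rel l) ∘ g ≡ tgt (obj Rel l) ∘ f) →
               M l g → M l f → M l (comp (obj Rel l) ∘ pair g f q)
      M-inv : ∀ l {J} (g f : Hom J (Ob₁ (obj Rel l))) → IsInverse (obj Rel l) g f → M l f → M l g
      M-reindex : ∀ l {J J'} (f : Hom J (Ob₁ (obj Rel l))) (r : Hom J' J) → M l f → M l (f ∘ r)
  open GoodIsos public

  record HasProducts {p : ℕ∞} {m : Level} (Rel : CubicalCat p) (𝓜 : GoodIsos Rel m) : Set (o ⊔ ℓ ⊔ m) where
    private
      R : Lvl p → ICat
      R = obj Rel
    field
      prod : ∀ l → Hom (Ob₀ (R l) ×ₒ Ob₀ (R l)) (Ob₀ (R l))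
      fst snd : ∀ l → Hom (Ob₀ (R l) ×ₒ Ob₀ (R l)) (Ob₁ (R l))
      src-fst : ∀ l → src (R l) ∘ fst l ≡ prod l
      tgt-fst : ∀ l → tgt (R l) ∘ fst l ≡ π₁
      src-snd : ∀ l → src (R l) ∘ snd l ≡ prod l
      tgt-snd : ∀ l → tgt (R l) ∘ snd l ≡ π₂
      ppair : ∀ l → Hom (PB (src (R l)) (src (R l))) (Ob₁ (R l))
      src-ppair : ∀ l → src (R l) ∘ ppair l ≡ src (R l) ∘ p₁
      tgt-ppair : ∀ l → tgt (R l) ∘ ppair l ≡ prod l ∘ ⟨ tgt (R l) ∘ p₁ , tgt (R l) ∘ p₂ ⟩
      fst-ppair : ∀ l (q : src (R l) ∘ (fst l ∘ ⟨ tgt (R l) ∘ p₁ , tgt (R l) ∘ p₂ ⟩) ≡ tgt (R l) ∘ ppair l) →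
                  comp (R l) ∘ pair (fst l ∘ ⟨ tgt (R l) ∘ p₁ , tgt (R l) ∘ p₂ ⟩) (ppair l) q ≡ p₁
      snd-ppair : ∀ l (q : src (R l) ∘ (snd l ∘ ⟨ tgt (R l) ∘ p₁ , tgt (R l) ∘ p₂ ⟩) ≡ tgt (R l) ∘ ppair l) →
                  comp (R l) ∘ pair (snd l ∘ ⟨ tgt (R l) ∘ p₁ , tgt (R l) ∘ p₂ ⟩) (ppair l) q ≡ p₂
      ppair-unique : ∀ l {J} (b c : Hom J (Ob₀ (R l))) (h : Hom J (Ob₁ (R l)))
                     (q₁ : src (R l) ∘ (fst l ∘ ⟨ b , c ⟩) ≡ tgt (R l) ∘ h)
                     (q₂ : src (R l) ∘ (snd l ∘ ⟨ b , c ⟩) ≡ tgt (R l) ∘ h)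
                     (s : src (R l) ∘ (comp (R l) ∘ pair (fst l ∘ ⟨ b , c ⟩) h q₁)
                          ≡ src (R l) ∘ (comp (R l) ∘ pair (snd l ∘ ⟨ b , c ⟩) h q₂)) →
                     h ≡ ppair l ∘ pair (comp (R l) ∘ pair (fst l ∘ ⟨ b , c ⟩) h q₁)
                                        (comp (R l) ∘ pair (snd l ∘ ⟨ b , c ⟩) h q₂) s
      -- M(l) closed under products:  f ×_l g = ⟨ f ∘ fst , g ∘ snd ⟩
      M-prod : ∀ l {J} (f g : Hom J (Ob₁ (R l))) →
               (q₁ : src (R l) ∘ f ≡ tgt (R l) ∘ (fst l ∘ ⟨ src (R l) ∘ f , src (R l) ∘ g ⟩))
               (q₂ : src (R l) ∘ g ≡ tgt (R l) ∘ (snd l ∘ ⟨ src (R l) ∘ f , src (R l) ∘ g ⟩))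
               (s : src (R l) ∘ (comp (R l) ∘ pair f (fst l ∘ ⟨ src (R l) ∘ f , src (R l) ∘ g ⟩) q₁)
                    ≡ src (R l) ∘ (comp (R l) ∘ pair g (snd l ∘ ⟨ src (R l) ∘ f , src (R l) ∘ g ⟩) q₂)) →
               M 𝓜 l f → M 𝓜 l g →
               M 𝓜 l (ppair l ∘ pair (comp (R l) ∘ pair f (fst l ∘ ⟨ src (R l) ∘ f , src (R l) ∘ g ⟩) q₁)
                                     (comp (R l) ∘ pair g (snd l ∘ ⟨ src (R l) ∘ f , src (R l) ∘ g ⟩) q₂) s)
  open HasProducts public

  StableUnderFaces : ∀ {p m} {Rel : CubicalCat p} {𝓜 : GoodIsos Rel m} → HasProducts Rel 𝓜 → Set (o ⊔ ℓ)
  StableUnderFaces {p} {Rel = Rel} P =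
    ∀ (⋆ : Bool) (l : ℕ) (k : Fin (suc l)) .(b : suc l ≤∞ p) →
    let h = face ⋆ l k b
        a = mkL {p} (suc l) b
        c = mkL {p} l (≤∞-pred b)
        H₀ = F₀ (act Rel h)
        H₁ = F₁ (act Rel h)
    in ∀ {J} (A B : Hom J (Ob₀ (obj Rel a))) →
       (H₀ ∘ (prod P a ∘ ⟨ A , B ⟩) ≡ prod P c ∘ ⟨ H₀ ∘ A , H₀ ∘ B ⟩)
     × (H₁ ∘ (fst P a ∘ ⟨ A , B ⟩) ≡ fst P c ∘ ⟨ H₀ ∘ A , H₀ ∘ B ⟩)
     × (H₁ ∘ (snd P a ∘ ⟨ A , B ⟩) ≡ snd P c ∘ ⟨ H₀ ∘ A , H₀ ∘ B ⟩)

  -- stability under degeneracies: chosen ε(h,A,B) (internally, at the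
  -- universal pair of objects A = π₁ , B = π₂ on Ob₀ × Ob₀)
  record DegenIso {p m} {Rel : CubicalCat p} {𝓜 : GoodIsos Rel m} (P : HasProducts Rel 𝓜)
                  {a c : Lvl p} (h : Gen a c) : Set (o ⊔ ℓ ⊔ m) where
    private
      H₀ = F₀ (act Rel h)
      H₁ = F₁ (act Rel h)
      Rc = obj Rel c
    field
      ε : Hom (Ob₀ (obj Rel a) ×ₒ Ob₀ (obj Rel a)) (Ob₁ Rc)
      ε-M : M 𝓜 c ε
      ε-src : src Rc ∘ ε ≡ H₀ ∘ prod P a
      ε-tgt : tgt Rc ∘ ε ≡ prod P c ∘ (H₀ ×₁ H₀)
      ε-fst : (q : src Rc ∘ (fst P c ∘ (H₀ ×₁ H₀)) ≡ tgt Rc ∘ ε) →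
              comp Rc ∘ pair (fst P c ∘ (H₀ ×₁ H₀)) ε q ≡ H₁ ∘ fst P a
      ε-snd : (q : src Rc ∘ (snd P c ∘ (H₀ ×₁ H₀)) ≡ tgt Rc ∘ ε) →
              comp Rc ∘ pair (snd P c ∘ (H₀ ×₁ H₀)) ε q ≡ H₁ ∘ snd P a

  StableUnderDegeneracies : ∀ {p m} {Rel : CubicalCat p} {𝓜 : GoodIsos Rel m} → HasProducts Rel 𝓜 → Set (o ⊔ ℓ ⊔ m)
  StableUnderDegeneracies {p} P =
    ∀ (l : ℕ) (k : Fin (suc l)) .(b : suc l ≤∞ p) → DegenIso P (degen l k b)

  Disc : ∀ {p} (Rel : CubicalCat p) (n : ℕ) (l : Lvl p) → ICat
  Disc Rel n l = record
    { Ob₀ = Ob₀ (obj Rel l) ^ n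
    ; Ob₁ = Ob₀ (obj Rel l) ^ n
    ; src = id ; tgt = id ; idn = id
    ; comp = p₁
    ; src-idn = idˡ id ; tgt-idn = idˡ id
    ; src-comp = pcomm
    ; tgt-comp = Relation.Binary.PropositionalEquality.refl
    ; comp-idˡ = λ f q → trans (p₁∘pair _ f q) (trans (idˡ _) (idˡ f))
    ; comp-idʳ = λ f q → p₁∘pair f _ q
    ; comp-assoc = λ h g f q₁ q₂ q₃ q₄ →
        trans (p₁∘pair _ f q₃) (trans (p₁∘pair h g q₁) (sym (p₁∘pair h _ q₄)))
    }

  module _ {p : ℕ∞} {m : Level} (Rel : CubicalCat p) (𝓜 : GoodIsos Rel m) (n : ℕ) where
    private
      R : Lvl p → ICat
      R = obj Rel
      R₀ R₁ : Lvl p → Obj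
      R₀ l = Ob₀ (R l)
      R₁ l = Ob₁ (R l)

    record FObj : Set (o ⊔ ℓ ⊔ m) where
      field
        𝓕 : ∀ l → IFunctor (Disc Rel n l) (R l)
        face-pres : ∀ (⋆ : Bool) (l : ℕ) (k : Fin (suc l)) .(b : suc l ≤∞ p) →
          let h = face ⋆ l k b
              a = mkL {p} (suc l) b
              c = mkL {p} l (≤∞-pred b)
          in (F₀ (act Rel h) ∘ F₀ (𝓕 a) ≡ F₀ (𝓕 c) ∘ pow n (F₀ (act Rel h)))
           × (F₁ (act Rel h) ∘ F₁ (𝓕 a) ≡ F₁ (𝓕 c) ∘ pow n (F₀ (act Rel h)))
        εF : ∀ (l : ℕ) (k : Fin (suc l)) .(b : suc l ≤∞ p) →
          let h = degen l k b
              a = mkL {p} l (≤∞-pred b)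
              c = mkL {p} (suc l) b
          in INatTrans (Disc Rel n a) (R c)
               (F₀ (act Rel h) ∘ F₀ (𝓕 a)) (F₁ (act Rel h) ∘ F₁ (𝓕 a))
               (F₀ (𝓕 c) ∘ pow n (F₀ (act Rel h))) (F₁ (𝓕 c) ∘ pow n (F₀ (act Rel h)))
        εF-M : ∀ (l : ℕ) (k : Fin (suc l)) .(b : suc l ≤∞ p) →
          M 𝓜 (mkL {p} (suc l) b) (η (εF l k b))
        υ : ∀ l (m' : ℕ) (f : Hom (R₀ l ^ m') (R₁ l ^ n)) →
            .(∀ (k : Fin n) → M 𝓜 l (proj k ∘ f)) → Hom (R₀ l ^ m') (R₁ l)
        υ-M : ∀ l m' f .(pf : ∀ (k : Fin n) → M 𝓜 l (proj k ∘ f)) → M 𝓜 l (υ l m' f pf)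
        υ-src : ∀ l m' f .(pf : ∀ (k : Fin n) → M 𝓜 l (proj k ∘ f)) →
                src (R l) ∘ υ l m' f pf ≡ F₀ (𝓕 l) ∘ (pow n (src (R l)) ∘ f)
        υ-tgt : ∀ l m' f .(pf : ∀ (k : Fin n) → M 𝓜 l (proj k ∘ f)) →
                tgt (R l) ∘ υ l m' f pf ≡ F₀ (𝓕 l) ∘ (pow n (tgt (R l)) ∘ f)
        υ-id : ∀ l m' (x : Hom (R₀ l ^ m') (R₀ l ^ n))
               .(pf : ∀ (k : Fin n) → M 𝓜 l (proj k ∘ (pow n (idn (R l)) ∘ x))) →
               υ l m' (pow n (idn (R l)) ∘ x) pf ≡ F₁ (𝓕 l) ∘ x
        υ-comp : ∀ l m' (g f : Hom (R₀ l ^ m') (R₁ l ^ n))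
                 (ck : ∀ (k : Fin n) → src (R l) ∘ (proj k ∘ g) ≡ tgt (R l) ∘ (proj k ∘ f))
                 .(pg : ∀ (k : Fin n) → M 𝓜 l (proj k ∘ g))
                 .(pf : ∀ (k : Fin n) → M 𝓜 l (proj k ∘ f))
                 .(pgf : ∀ (k : Fin n) → M 𝓜 l (proj k ∘ tuple n (λ k → comp (R l) ∘ pair (proj k ∘ g) (proj k ∘ f) (ck k))))
                 (q : src (R l) ∘ υ l m' g pg ≡ tgt (R l) ∘ υ l m' f pf) →
                 υ l m' (tuple n (λ k → comp (R l) ∘ pair (proj k ∘ g) (proj k ∘ f) (ck k))) pgf
                 ≡ comp (R l) ∘ pair (υ l m' g pg) (υ l m' f pf) q
        υ-reindex : ∀ l m' m'' (f : Hom (R₀ l ^ m') (R₁ l ^ n)) (r : Hom (R₀ l ^ m'') (R₀ l ^ m'))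
                    .(pf : ∀ (k : Fin n) → M 𝓜 l (proj k ∘ f))
                    .(pfr : ∀ (k : Fin n) → M 𝓜 l (proj k ∘ (f ∘ r))) →
                    υ l m'' (f ∘ r) pfr ≡ υ l m' f pf ∘ r
    open FObj public

    record FHom (𝔽 𝔾 : FObj) : Set (o ⊔ ℓ) where
      field
        ηc : ∀ l → INatTrans (Disc Rel n l) (R l)
                     (F₀ (𝓕 𝔽 l)) (F₁ (𝓕 𝔽 l)) (F₀ (𝓕 𝔾 l)) (F₁ (𝓕 𝔾 l))
        ηc-face : ∀ (⋆ : Bool) (l : ℕ) (k : Fin (suc l)) .(b : suc l ≤∞ p) →
          let h = face ⋆ l k b
              a = mkL {p} (suc l) b
              c = mkL {p} l (≤∞-pred b)
          in F₁ (act Rel h) ∘ η (ηc a) ≡ η (ηc c) ∘ pow n (F₀ (act Rel h))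
        ηc-degen : ∀ (l : ℕ) (k : Fin (suc l)) .(b : suc l ≤∞ p) →
          let h = degen l k b
              a = mkL {p} l (≤∞-pred b)
              c = mkL {p} (suc l) b
              Rc = R c
          in (q : src Rc ∘ (η (ηc c) ∘ pow n (F₀ (act Rel h))) ≡ tgt Rc ∘ η (εF 𝔽 l k b))
             (q' : src Rc ∘ η (εF 𝔾 l k b) ≡ tgt Rc ∘ (F₁ (act Rel h) ∘ η (ηc a))) →
             comp Rc ∘ pair (η (ηc c) ∘ pow n (F₀ (act Rel h))) (η (εF 𝔽 l k b)) q
             ≡ comp Rc ∘ pair (η (εF 𝔾 l k b)) (F₁ (act Rel h) ∘ η (ηc a)) q'
    open FHom public

    compC : ∀ {𝔽 𝔾 ℍ : FObj} → FHom 𝔾 ℍ → FHom 𝔽 𝔾 → ∀ l → Hom (R₀ l ^ n) (R₁ l)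
    compC θ φ l = comp (R l) ∘ pair (η (ηc θ l)) (η (ηc φ l))
                    (trans (η-src (ηc θ l)) (sym (η-tgt (ηc φ l))))

    _≈F_ : ∀ {𝔽 𝔾 : FObj} → (∀ l → Hom (R₀ l ^ n) (R₁ l)) → FHom 𝔽 𝔾 → Set ℓ
    θ ≈F φ = ∀ l → θ l ≡ η (ηc φ l)

    record BinaryProducts : Set (o ⊔ ℓ ⊔ m) where
      field
        _⊗_ : FObj → FObj → FObj
        fstF : ∀ {𝔽 𝔾} → FHom (𝔽 ⊗ 𝔾) 𝔽
        sndF : ∀ {𝔽 𝔾} → FHom (𝔽 ⊗ 𝔾) 𝔾
        ⟪_,_⟫ : ∀ {ℍ 𝔽 𝔾} → FHom ℍ 𝔽 → FHom ℍ 𝔾 → FHom ℍ (𝔽 ⊗ 𝔾)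
        fst∘⟪⟫ : ∀ {ℍ 𝔽 𝔾} (f : FHom ℍ 𝔽) (g : FHom ℍ 𝔾) → compC fstF ⟪ f , g ⟫ ≈F f
        snd∘⟪⟫ : ∀ {ℍ 𝔽 𝔾} (f : FHom ℍ 𝔽) (g : FHom ℍ 𝔾) → compC sndF ⟪ f , g ⟫ ≈F g
        ⟪⟫-unique : ∀ {ℍ 𝔽 𝔾} (f : FHom ℍ 𝔽) (g : FHom ℍ 𝔾) (h : FHom ℍ (𝔽 ⊗ 𝔾)) →
                    compC fstF h ≈F f → compC sndF h ≈F g → (λ l → η (ηc h l)) ≈F ⟪ f , g ⟫

-- The product 𝔽 ⊗ 𝔾 is computed levelwise in Rel: at level l it is the discrete functor
-- 𝔽(l) ×ₗ 𝔾(l), whose projections and pairings are those of ×ₗ taken componentwise.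
-- Stability under face maps makes it face map-preserving. For a degeneracy h the witness is
-- (ε_𝔽(h) ×ₗ ε_𝔾(h)) ∘ ε(h, 𝔽, 𝔾), which lies in M because M is closed under products,
-- composition and reindexing; likewise υ_{𝔽⊗𝔾} = υ_𝔽 ×ₗ υ_𝔾. Every remaining equation is
-- an instance of the universal property of ×ₗ, checked on generalized elements J → Rel(l)₁.
module Submission where

open import Defs
open import Level using (Level; _⊔_)
open import Data.Nat using (ℕ; zero; suc)
open import Data.Fin using (Fin) renaming (zero to fzero; suc to fsuc)
open import Data.Bool using (Bool)
open import Data.Product using (_,_; proj₁; proj₂)
open import Relation.Binary.PropositionalEquality using (_≡_; refl; sym; trans; cong; cong₂; subst; module ≡-Reasoning)

module Construction {o ℓ : Level} (𝒞 : FinCompleteCategory o ℓ) where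
  open FinCompleteCategory 𝒞
  open Internal 𝒞

  private variable
    X : ICat
    A B C D J J' : Obj

  pullˡ : {f : Hom B C} {g : Hom A B} {h : Hom A C} {r : Hom J A} → f ∘ g ≡ h → f ∘ (g ∘ r) ≡ h ∘ r
  pullˡ {r = r} e = trans (sym (assoc _ _ _)) (cong (_∘ r) e)

  pullʳ : {f : Hom C D} {g : Hom B C} {h : Hom A C} {r : Hom A B} → g ∘ r ≡ h → (f ∘ g) ∘ r ≡ f ∘ h
  pullʳ {f = f} e = trans (assoc _ _ _) (cong (f ∘_) e)

  pair-irrelevant : {f : Hom A C} {g : Hom B C} {u : Hom J A} {v : Hom J B}
                    (q q' : f ∘ u ≡ g ∘ v) → pair {f = f} {g} u v q ≡ pair u v q'
  pair-irrelevant {u = u} {v} q q' = pair-unique (pair u v q) u v q' (p₁∘pair u v q) (p₂∘pair u v q)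

  pair-cong : {f : Hom A C} {g : Hom B C} {u u' : Hom J A} {v v' : Hom J B}
              {q : f ∘ u ≡ g ∘ v} {q' : f ∘ u' ≡ g ∘ v'} → u ≡ u' → v ≡ v' → pair u v q ≡ pair u' v' q'
  pair-cong refl refl = pair-irrelevant _ _

  pair-∘ : {f : Hom A C} {g : Hom B C} {u : Hom J A} {v : Hom J B} (q : f ∘ u ≡ g ∘ v) (r : Hom J' J)
           (q' : f ∘ (u ∘ r) ≡ g ∘ (v ∘ r)) → pair u v q ∘ r ≡ pair (u ∘ r) (v ∘ r) q'
  pair-∘ {u = u} {v} q r q' = pair-unique _ _ _ q' (pullˡ (p₁∘pair u v q)) (pullˡ (p₂∘pair u v q))

  ⟨⟩-∘ : (f : Hom J A) (g : Hom J B) (r : Hom J' J) → ⟨ f , g ⟩ ∘ r ≡ ⟨ f ∘ r , g ∘ r ⟩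
  ⟨⟩-∘ f g r = ⟨⟩-unique _ _ _ (pullˡ (π₁∘⟨⟩ f g)) (pullˡ (π₂∘⟨⟩ f g))

  ×₁∘⟨⟩ : (f : Hom A C) (g : Hom B D) (u : Hom J A) (v : Hom J B) → (f ×₁ g) ∘ ⟨ u , v ⟩ ≡ ⟨ f ∘ u , g ∘ v ⟩
  ×₁∘⟨⟩ f g u v = trans (⟨⟩-∘ _ _ _) (cong₂ ⟨_,_⟩ (pullʳ (π₁∘⟨⟩ u v)) (pullʳ (π₂∘⟨⟩ u v)))

  proj∘tuple : ∀ n (fs : Fin n → Hom J A) (k : Fin n) → proj {A} k ∘ tuple n fs ≡ fs k
  proj∘tuple (suc n) fs fzero    = π₁∘⟨⟩ _ _
  proj∘tuple (suc n) fs (fsuc k) = trans (pullʳ (π₂∘⟨⟩ _ _)) (proj∘tuple n _ k)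

  proj-ext : ∀ n (f g : Hom J (A ^ n)) → (∀ (k : Fin n) → proj {A} k ∘ f ≡ proj k ∘ g) → f ≡ g
  proj-ext zero    f g e = trans (!-unique f) (sym (!-unique g))
  proj-ext (suc n) f g e =
    trans (⟨⟩-unique f _ _ (e fzero) (proj-ext n (π₂ ∘ f) (π₂ ∘ g) λ k →
                                        trans (sym (assoc _ _ _)) (trans (e (fsuc k)) (assoc _ _ _))))
          (sym (⟨⟩-unique g _ _ refl refl))

  pow∘-ext : ∀ n {h h' : Hom A B} {f g : Hom J (A ^ n)} →
             (∀ (k : Fin n) → h ∘ (proj {A} k ∘ f) ≡ h' ∘ (proj k ∘ g)) → pow n h ∘ f ≡ pow n h' ∘ g
  pow∘-ext n e = proj-ext n _ _ λ k →
    trans (pullˡ (proj∘tuple n _ k)) (trans (assoc _ _ _) (trans (e k)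
      (sym (trans (pullˡ (proj∘tuple n _ k)) (assoc _ _ _)))))

  src∘comp : (g f : Hom J (Ob₁ X)) (q : src X ∘ g ≡ tgt X ∘ f) → src X ∘ (comp X ∘ pair g f q) ≡ src X ∘ f
  src∘comp {X = X} g f q = trans (pullˡ (src-comp X)) (pullʳ (p₂∘pair g f q))

  tgt∘comp : (g f : Hom J (Ob₁ X)) (q : src X ∘ g ≡ tgt X ∘ f) → tgt X ∘ (comp X ∘ pair g f q) ≡ tgt X ∘ g
  tgt∘comp {X = X} g f q = trans (pullˡ (tgt-comp X)) (pullʳ (p₁∘pair g f q))

  record Mor (X : ICat) {J : Obj} (a b : Hom J (Ob₀ X)) : Set ℓ where
    constructor mor
    field
      arr : Hom J (Ob₁ X)
      arr-src : src X ∘ arr ≡ a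
      arr-tgt : tgt X ∘ arr ≡ b
  open Mor public

  -- A record rather than arr F ≡ arr G, so that F and G can be inferred from it.
  infix 4 _≈_
  record _≈_ {X : ICat} {J : Obj} {a b a' b' : Hom J (Ob₀ X)} (F : Mor X a b) (G : Mor X a' b') : Set ℓ where
    constructor ≡⇒≈
    field ≈⇒≡ : arr F ≡ arr G
  open _≈_ public

  module _ {X : ICat} {J : Obj} where
    private variable
      a b c d a' b' c' d' : Hom J (Ob₀ X)

    ≈-refl : {F : Mor X a b} → F ≈ F
    ≈-refl = ≡⇒≈ refl

    ≈-sym : {F : Mor X a b} {G : Mor X a' b'} → F ≈ G → G ≈ F
    ≈-sym (≡⇒≈ e) = ≡⇒≈ (sym e)

    ≈-trans : {F : Mor X a b} {G : Mor X a' b'} {K : Mor X c d} → F ≈ G → G ≈ K → F ≈ K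
    ≈-trans (≡⇒≈ e) (≡⇒≈ e') = ≡⇒≈ (trans e e')

    module ≈-Reasoning where
      infix  1 begin_
      infixr 2 _≈⟨_⟩_ _≈˘⟨_⟩_
      infix  3 _∎

      begin_ : {F : Mor X a b} {G : Mor X a' b'} → F ≈ G → F ≈ G
      begin e = e

      _≈⟨_⟩_ : (F : Mor X a b) {G : Mor X a' b'} {K : Mor X c d} → F ≈ G → G ≈ K → F ≈ K
      _ ≈⟨ e ⟩ e' = ≈-trans e e'

      _≈˘⟨_⟩_ : (F : Mor X a b) {G : Mor X a' b'} {K : Mor X c d} → G ≈ F → G ≈ K → F ≈ K
      _ ≈˘⟨ e ⟩ e' = ≈-trans (≈-sym e) e'

      _∎ : (F : Mor X a b) → F ≈ F
      _ ∎ = ≈-refl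

    composable : (G : Mor X b c) (F : Mor X a b) → src X ∘ arr G ≡ tgt X ∘ arr F
    composable G F = trans (arr-src G) (sym (arr-tgt F))

    -- Opaque: a composite is only ever unfolded by ⊚-arr, for whichever composability proof is at hand.
    infixr 9 _⊚_
    opaque
      _⊚_ : Mor X b c → Mor X a b → Mor X a c
      G ⊚ F = mor (comp X ∘ pair (arr G) (arr F) (composable G F))
                  (trans (src∘comp {X = X} _ _ _) (arr-src F)) (trans (tgt∘comp {X = X} _ _ _) (arr-tgt G))

      ⊚-arr : (G : Mor X b c) (F : Mor X a b) (q : src X ∘ arr G ≡ tgt X ∘ arr F) →
              arr (G ⊚ F) ≡ comp X ∘ pair (arr G) (arr F) q
      ⊚-arr G F q = cong (comp X ∘_) (pair-irrelevant (composable G F) q)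

    ⊚-arr′ : {G : Mor X b c} {F : Mor X a b} {g f : Hom J (Ob₁ X)} → arr G ≡ g → arr F ≡ f →
             (q : src X ∘ g ≡ tgt X ∘ f) → arr (G ⊚ F) ≡ comp X ∘ pair g f q
    ⊚-arr′ {G = G} {F} eG eF q = trans (⊚-arr G F (composable G F)) (cong (comp X ∘_) (pair-cong eG eF))

    ⊚-resp-≈ : {G : Mor X b c} {F : Mor X a b} {G' : Mor X b' c'} {F' : Mor X a' b'} →
               G ≈ G' → F ≈ F' → G ⊚ F ≈ G' ⊚ F'
    ⊚-resp-≈ {G' = G'} {F'} (≡⇒≈ eG) (≡⇒≈ eF) = ≡⇒≈ (trans (⊚-arr′ eG eF q) (sym (⊚-arr G' F' q)))
      where q = composable G' F'

    ⊚-assoc : (H : Mor X c d) (G : Mor X b c) (F : Mor X a b) → (H ⊚ G) ⊚ F ≈ H ⊚ (G ⊚ F)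
    ⊚-assoc H G F = ≡⇒≈ (trans (⊚-arr′ (⊚-arr H G q₁) refl q₃)
                                   (trans (comp-assoc X (arr H) (arr G) (arr F) q₁ q₂ q₃ q₄)
                                          (sym (⊚-arr′ refl (⊚-arr G F q₂) q₄))))
      where
        q₁ = composable H G
        q₂ = composable G F
        q₃ = trans (src∘comp {X = X} _ _ q₁) q₂
        q₄ = trans q₁ (sym (tgt∘comp {X = X} _ _ q₂))

    src∘idn : (x : Hom J (Ob₀ X)) → src X ∘ (idn X ∘ x) ≡ x
    src∘idn x = trans (pullˡ (src-idn X)) (idˡ x)

    tgt∘idn : (x : Hom J (Ob₀ X)) → tgt X ∘ (idn X ∘ x) ≡ x
    tgt∘idn x = trans (pullˡ (tgt-idn X)) (idˡ x)

    idM : (a : Hom J (Ob₀ X)) → Mor X a a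
    idM a = mor (idn X ∘ a) (src∘idn a) (tgt∘idn a)

    ⊚-identityˡ : (F : Mor X a b) → idM b ⊚ F ≈ F
    ⊚-identityˡ F = ≡⇒≈ (trans (⊚-arr′ (cong (idn X ∘_) (sym (arr-tgt F))) refl q) (comp-idˡ X (arr F) q))
      where q = src∘idn (tgt X ∘ arr F)

    ⊚-identityʳ : (F : Mor X a b) → F ⊚ idM a ≈ F
    ⊚-identityʳ F = ≡⇒≈ (trans (⊚-arr′ refl (cong (idn X ∘_) (sym (arr-src F))) q) (comp-idʳ X (arr F) q))
      where q = sym (tgt∘idn (src X ∘ arr F))

    src-≈ : {F : Mor X a b} {G : Mor X a' b'} → F ≈ G → a ≡ a'
    src-≈ {F = F} {G} (≡⇒≈ e) = trans (sym (arr-src F)) (trans (cong (src X ∘_) e) (arr-src G))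

    comp∘idn-idn : (x : Hom J (Ob₀ X)) (q : src X ∘ (idn X ∘ x) ≡ tgt X ∘ (idn X ∘ x)) →
                   comp X ∘ pair (idn X ∘ x) (idn X ∘ x) q ≡ idn X ∘ x
    comp∘idn-idn x q = trans (sym (⊚-arr (idM x) (idM x) q)) (≈⇒≡ (⊚-identityˡ (idM x)))

    cast : a ≡ a' → b ≡ b' → Mor X a b → Mor X a' b'
    cast e e' F = mor (arr F) (trans (arr-src F) e) (trans (arr-tgt F) e')

  infixl 10 _⊙_
  _⊙_ : {a b : Hom J (Ob₀ X)} → Mor X a b → (r : Hom J' J) → Mor X (a ∘ r) (b ∘ r)
  F ⊙ r = mor (arr F ∘ r) (pullˡ (arr-src F)) (pullˡ (arr-tgt F))

  ⊙-distrib-⊚ : {a b c : Hom J (Ob₀ X)} (G : Mor X b c) (F : Mor X a b) (r : Hom J' J) →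
                (G ⊚ F) ⊙ r ≈ (G ⊙ r) ⊚ (F ⊙ r)
  ⊙-distrib-⊚ {X = X} G F r = ≡⇒≈ (trans (cong (_∘ r) (⊚-arr G F _))
    (trans (assoc _ _ _) (trans (cong (comp X ∘_) (pair-∘ (composable G F) r (composable (G ⊙ r) (F ⊙ r))))
      (sym (⊚-arr (G ⊙ r) (F ⊙ r) _)))))

  module _ {X Y : ICat} (H : IFunctor X Y) {J : Obj} where
    private
      module H = IsIFunctor (isIFunctor H)
      variable
        a b c a' b' : Hom J (Ob₀ X)

    map : Mor X a b → Mor Y (F₀ H ∘ a) (F₀ H ∘ b)
    map U = mor (F₁ H ∘ arr U) (trans (pullˡ H.F-src) (pullʳ (arr-src U)))
                               (trans (pullˡ H.F-tgt) (pullʳ (arr-tgt U)))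

    map-resp-≈ : {U : Mor X a b} {V : Mor X a' b'} → U ≈ V → map U ≈ map V
    map-resp-≈ (≡⇒≈ e) = ≡⇒≈ (cong (F₁ H ∘_) e)

    map-⊚ : (G : Mor X b c) (F : Mor X a b) → map (G ⊚ F) ≈ map G ⊚ map F
    map-⊚ G F = ≡⇒≈ (trans (cong (F₁ H ∘_) (⊚-arr G F q))
                      (trans (H.F-comp _ _ q q') (sym (⊚-arr (map G) (map F) q'))))
      where
        q = composable G F
        q' = composable (map G) (map F)

    map-⊚≈ : {G : Mor X b c} {F : Mor X a b} {K : Mor X a' b'} → G ⊚ F ≈ K → map G ⊚ map F ≈ map K
    map-⊚≈ {G = G} {F} e = ≈-trans (≈-sym (map-⊚ G F)) (map-resp-≈ e)

    map-idM : (x : Hom J (Ob₀ X)) → map (idM x) ≈ idM (F₀ H ∘ x)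
    map-idM x = ≡⇒≈ (trans (pullˡ H.F-idn) (assoc (idn Y) (F₀ H) x))

  module Products {p : ℕ∞} {m : Level} {Rel : CubicalCat p} {𝓜 : GoodIsos Rel m}
                  (P : HasProducts Rel 𝓜) {l : Lvl p} where
    private
      Rₗ : ICat
      Rₗ = obj Rel l

    infixr 7 _×₀_
    _×₀_ : Hom J (Ob₀ Rₗ) → Hom J (Ob₀ Rₗ) → Hom J (Ob₀ Rₗ)
    b ×₀ c = prod P l ∘ ⟨ b , c ⟩

    fstᴹ : (b c : Hom J (Ob₀ Rₗ)) → Mor Rₗ (b ×₀ c) b
    fstᴹ b c = mor (fst P l ∘ ⟨ b , c ⟩) (pullˡ (src-fst P l)) (trans (pullˡ (tgt-fst P l)) (π₁∘⟨⟩ b c))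

    sndᴹ : (b c : Hom J (Ob₀ Rₗ)) → Mor Rₗ (b ×₀ c) c
    sndᴹ b c = mor (snd P l ∘ ⟨ b , c ⟩) (pullˡ (src-snd P l)) (trans (pullˡ (tgt-snd P l)) (π₂∘⟨⟩ b c))

    fstᴹ-⊙ : (b c : Hom J (Ob₀ Rₗ)) (r : Hom J' J) → fstᴹ b c ⊙ r ≈ fstᴹ (b ∘ r) (c ∘ r)
    fstᴹ-⊙ b c r = ≡⇒≈ (pullʳ (⟨⟩-∘ b c r))

    sndᴹ-⊙ : (b c : Hom J (Ob₀ Rₗ)) (r : Hom J' J) → sndᴹ b c ⊙ r ≈ sndᴹ (b ∘ r) (c ∘ r)
    sndᴹ-⊙ b c r = ≡⇒≈ (pullʳ (⟨⟩-∘ b c r))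

    fstᴹ-cong : {b c b' c' : Hom J (Ob₀ Rₗ)} → b ≡ b' → c ≡ c' → fstᴹ b c ≈ fstᴹ b' c'
    fstᴹ-cong e e' = ≡⇒≈ (cong (fst P l ∘_) (cong₂ ⟨_,_⟩ e e'))

    sndᴹ-cong : {b c b' c' : Hom J (Ob₀ Rₗ)} → b ≡ b' → c ≡ c' → sndᴹ b c ≈ sndᴹ b' c'
    sndᴹ-cong e e' = ≡⇒≈ (cong (snd P l ∘_) (cong₂ ⟨_,_⟩ e e'))

    ×₀-∘ : (b c : Hom J (Ob₀ Rₗ)) (r : Hom J' J) → (b ×₀ c) ∘ r ≡ (b ∘ r) ×₀ (c ∘ r)
    ×₀-∘ b c r = pullʳ (⟨⟩-∘ b c r)

    -- The universal span with a common source; ppair on it classifies all such spans.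
    private
      T₁ T₂ : Hom (PB (src Rₗ) (src Rₗ)) (Ob₀ Rₗ)
      T₁ = tgt Rₗ ∘ p₁
      T₂ = tgt Rₗ ∘ p₂

      pairing : Mor Rₗ (src Rₗ ∘ p₁) (T₁ ×₀ T₂)
      pairing = mor (ppair P l) (src-ppair P l) (tgt-ppair P l)

    module _ {J : Obj} where
      private variable
        a b c d a' b' c' d' : Hom J (Ob₀ Rₗ)

      span : Mor Rₗ a b → Mor Rₗ a c → Hom J (PB (src Rₗ) (src Rₗ))
      span U V = pair (arr U) (arr V) (trans (arr-src U) (sym (arr-src V)))

      T∘span : (U : Mor Rₗ a b) (V : Mor Rₗ a c) → ⟨ T₁ , T₂ ⟩ ∘ span U V ≡ ⟨ b , c ⟩
      T∘span U V = trans (⟨⟩-∘ _ _ _) (cong₂ ⟨_,_⟩ (trans (pullʳ (p₁∘pair _ _ _)) (arr-tgt U))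
                                                   (trans (pullʳ (p₂∘pair _ _ _)) (arr-tgt V)))

      opaque
        ⟨_,_⟩ᴹ : Mor Rₗ a b → Mor Rₗ a c → Mor Rₗ a (b ×₀ c)
        ⟨ U , V ⟩ᴹ = mor (arr (pairing ⊙ span U V))
                         (trans (arr-src (pairing ⊙ span U V)) (trans (pullʳ (p₁∘pair _ _ _)) (arr-src U)))
                         (trans (arr-tgt (pairing ⊙ span U V)) (pullʳ (T∘span U V)))

        ⟨⟩ᴹ≈pairing⊙span : (U : Mor Rₗ a b) (V : Mor Rₗ a c) → ⟨ U , V ⟩ᴹ ≈ pairing ⊙ span U V
        ⟨⟩ᴹ≈pairing⊙span U V = ≡⇒≈ refl

      ⟨⟩ᴹ-arr′ : {U : Mor Rₗ a b} {V : Mor Rₗ a c} {u v : Hom J (Ob₁ Rₗ)} → arr U ≡ u → arr V ≡ v →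
                 (q : src Rₗ ∘ u ≡ src Rₗ ∘ v) → arr ⟨ U , V ⟩ᴹ ≡ ppair P l ∘ pair u v q
      ⟨⟩ᴹ-arr′ {U = U} {V} eU eV q = trans (≈⇒≡ (⟨⟩ᴹ≈pairing⊙span U V)) (cong (ppair P l ∘_) (pair-cong eU eV))

      ⟨⟩ᴹ-resp-≈ : {U : Mor Rₗ a b} {V : Mor Rₗ a c} {U' : Mor Rₗ a' b'} {V' : Mor Rₗ a' c'} →
                   U ≈ U' → V ≈ V' → ⟨ U , V ⟩ᴹ ≈ ⟨ U' , V' ⟩ᴹ
      ⟨⟩ᴹ-resp-≈ {U' = U'} {V'} (≡⇒≈ eU) (≡⇒≈ eV) =
        ≡⇒≈ (trans (⟨⟩ᴹ-arr′ eU eV _) (sym (⟨⟩ᴹ-arr′ refl refl (trans (arr-src U') (sym (arr-src V'))))))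

      fstᴹ∘⟨⟩ᴹ : (U : Mor Rₗ a b) (V : Mor Rₗ a c) → fstᴹ b c ⊚ ⟨ U , V ⟩ᴹ ≈ U
      fstᴹ∘⟨⟩ᴹ {b = b} {c} U V = begin
        fstᴹ b c ⊚ ⟨ U , V ⟩ᴹ                      ≈⟨ ⊚-resp-≈ (≡⇒≈ (sym (pullʳ (T∘span U V)))) (⟨⟩ᴹ≈pairing⊙span U V) ⟩
        (fstᴹ T₁ T₂ ⊙ span U V) ⊚ (pairing ⊙ span U V) ≈˘⟨ ⊙-distrib-⊚ (fstᴹ T₁ T₂) pairing (span U V) ⟩
        (fstᴹ T₁ T₂ ⊚ pairing) ⊙ span U V          ≈⟨ ≡⇒≈ (trans (cong (_∘ span U V) (trans (⊚-arr _ _ q) (fst-ppair P l q)))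
                                                                  (p₁∘pair _ _ _)) ⟩
        U ∎
        where
          open ≈-Reasoning
          q = composable (fstᴹ T₁ T₂) pairing

      sndᴹ∘⟨⟩ᴹ : (U : Mor Rₗ a b) (V : Mor Rₗ a c) → sndᴹ b c ⊚ ⟨ U , V ⟩ᴹ ≈ V
      sndᴹ∘⟨⟩ᴹ {b = b} {c} U V = begin
        sndᴹ b c ⊚ ⟨ U , V ⟩ᴹ                      ≈⟨ ⊚-resp-≈ (≡⇒≈ (sym (pullʳ (T∘span U V)))) (⟨⟩ᴹ≈pairing⊙span U V) ⟩
        (sndᴹ T₁ T₂ ⊙ span U V) ⊚ (pairing ⊙ span U V) ≈˘⟨ ⊙-distrib-⊚ (sndᴹ T₁ T₂) pairing (span U V) ⟩
        (sndᴹ T₁ T₂ ⊚ pairing) ⊙ span U V          ≈⟨ ≡⇒≈ (trans (cong (_∘ span U V) (trans (⊚-arr _ _ q) (snd-ppair P l q)))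
                                                                  (p₂∘pair _ _ _)) ⟩
        V ∎
        where
          open ≈-Reasoning
          q = composable (sndᴹ T₁ T₂) pairing

      ⟨⟩ᴹ-η : (K : Mor Rₗ a (b ×₀ c)) → K ≈ ⟨ fstᴹ b c ⊚ K , sndᴹ b c ⊚ K ⟩ᴹ
      ⟨⟩ᴹ-η {b = b} {c} K = ≡⇒≈ (trans (ppair-unique P l b c (arr K) q₁ q₂ s)
                                       (sym (⟨⟩ᴹ-arr′ (⊚-arr _ K q₁) (⊚-arr _ K q₂) s)))
        where
          q₁ = composable (fstᴹ b c) K
          q₂ = composable (sndᴹ b c) K
          s = trans (src∘comp {X = Rₗ} _ _ q₁) (sym (src∘comp {X = Rₗ} _ _ q₂))

      ⟨⟩ᴹ-unique : {K : Mor Rₗ a (b ×₀ c)} {U : Mor Rₗ a' b'} {V : Mor Rₗ a' c'} →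
                   fstᴹ b c ⊚ K ≈ U → sndᴹ b c ⊚ K ≈ V → K ≈ ⟨ U , V ⟩ᴹ
      ⟨⟩ᴹ-unique {K = K} e e' = ≈-trans (⟨⟩ᴹ-η K) (⟨⟩ᴹ-resp-≈ e e')

      ⟨⟩ᴹ-∘ : (U : Mor Rₗ b c) (V : Mor Rₗ b d) (W : Mor Rₗ a b) → ⟨ U , V ⟩ᴹ ⊚ W ≈ ⟨ U ⊚ W , V ⊚ W ⟩ᴹ
      ⟨⟩ᴹ-∘ U V W = ⟨⟩ᴹ-unique
        (≈-trans (≈-sym (⊚-assoc _ _ W)) (⊚-resp-≈ (fstᴹ∘⟨⟩ᴹ U V) ≈-refl))
        (≈-trans (≈-sym (⊚-assoc _ _ W)) (⊚-resp-≈ (sndᴹ∘⟨⟩ᴹ U V) ≈-refl))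

      infixr 8 _×ᴹ_
      _×ᴹ_ : Mor Rₗ a b → Mor Rₗ c d → Mor Rₗ (a ×₀ c) (b ×₀ d)
      _×ᴹ_ {a = a} {c = c} U V = ⟨ U ⊚ fstᴹ a c , V ⊚ sndᴹ a c ⟩ᴹ

      fstᴹ∘×ᴹ : (U : Mor Rₗ a b) (V : Mor Rₗ c d) → fstᴹ b d ⊚ (U ×ᴹ V) ≈ U ⊚ fstᴹ a c
      fstᴹ∘×ᴹ U V = fstᴹ∘⟨⟩ᴹ _ _

      sndᴹ∘×ᴹ : (U : Mor Rₗ a b) (V : Mor Rₗ c d) → sndᴹ b d ⊚ (U ×ᴹ V) ≈ V ⊚ sndᴹ a c
      sndᴹ∘×ᴹ U V = sndᴹ∘⟨⟩ᴹ _ _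

      ×ᴹ-resp-≈ : {U : Mor Rₗ a b} {V : Mor Rₗ c d} {U' : Mor Rₗ a' b'} {V' : Mor Rₗ c' d'} →
                  U ≈ U' → V ≈ V' → U ×ᴹ V ≈ U' ×ᴹ V'
      ×ᴹ-resp-≈ eU eV = ⟨⟩ᴹ-resp-≈ (⊚-resp-≈ eU (fstᴹ-cong (src-≈ eU) (src-≈ eV)))
                                   (⊚-resp-≈ eV (sndᴹ-cong (src-≈ eU) (src-≈ eV)))

      ×ᴹ-idM : {U : Mor Rₗ a b} {V : Mor Rₗ c d} → U ≈ idM a' → V ≈ idM c' → U ×ᴹ V ≈ idM (a' ×₀ c')
      ×ᴹ-idM {a' = a'} {c' = c'} eU eV = ≈-trans (×ᴹ-resp-≈ eU eV) (≈-sym (⟨⟩ᴹ-unique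
        (≈-trans (⊚-identityʳ (fstᴹ a' c')) (≈-sym (⊚-identityˡ (fstᴹ a' c'))))
        (≈-trans (⊚-identityʳ (sndᴹ a' c')) (≈-sym (⊚-identityˡ (sndᴹ a' c'))))))

      ×ᴹ-interchange : (G₁ : Mor Rₗ b c) (F₁ : Mor Rₗ a b) (G₂ : Mor Rₗ b' c') (F₂ : Mor Rₗ a' b') →
                       (G₁ ⊚ F₁) ×ᴹ (G₂ ⊚ F₂) ≈ (G₁ ×ᴹ G₂) ⊚ (F₁ ×ᴹ F₂)
      ×ᴹ-interchange G₁ F₁ G₂ F₂ = ≈-sym (begin
        (G₁ ×ᴹ G₂) ⊚ (F₁ ×ᴹ F₂)                                 ≈⟨ ⟨⟩ᴹ-∘ _ _ (F₁ ×ᴹ F₂) ⟩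
        ⟨ (G₁ ⊚ fstᴹ _ _) ⊚ (F₁ ×ᴹ F₂) , (G₂ ⊚ sndᴹ _ _) ⊚ (F₁ ×ᴹ F₂) ⟩ᴹ
          ≈⟨ ⟨⟩ᴹ-resp-≈ (≈-trans (⊚-assoc G₁ _ _) (≈-trans (⊚-resp-≈ ≈-refl (fstᴹ∘×ᴹ F₁ F₂)) (≈-sym (⊚-assoc G₁ F₁ _))))
                        (≈-trans (⊚-assoc G₂ _ _) (≈-trans (⊚-resp-≈ ≈-refl (sndᴹ∘×ᴹ F₁ F₂)) (≈-sym (⊚-assoc G₂ F₂ _)))) ⟩
        (G₁ ⊚ F₁) ×ᴹ (G₂ ⊚ F₂) ∎)
        where open ≈-Reasoning

      ⊚-M : (G : Mor Rₗ b c) (F : Mor Rₗ a b) → M 𝓜 l (arr G) → M 𝓜 l (arr F) → M 𝓜 l (arr (G ⊚ F))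
      ⊚-M G F MG MF = subst (M 𝓜 l) (sym (⊚-arr G F q)) (M-comp 𝓜 l _ _ q MG MF)
        where q = composable G F

      ×ᴹ-M : (U : Mor Rₗ a b) (V : Mor Rₗ c d) → M 𝓜 l (arr U) → M 𝓜 l (arr V) → M 𝓜 l (arr (U ×ᴹ V))
      ×ᴹ-M U V MU MV = subst (M 𝓜 l) (sym (≈⇒≡ (×ᴹ-resp-≈ {U' = U°} {V' = V°} (≡⇒≈ refl) (≡⇒≈ refl))))
        (subst (M 𝓜 l) (sym (⟨⟩ᴹ-arr′ (⊚-arr U° _ q₁) (⊚-arr V° _ q₂) s))
               (M-prod P l (arr U) (arr V) q₁ q₂ s MU MV))
        where
          U° = mor (arr U) refl (arr-tgt U)
          V° = mor (arr V) refl (arr-tgt V)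
          π₁ᴹ = fstᴹ (src Rₗ ∘ arr U) (src Rₗ ∘ arr V)
          π₂ᴹ = sndᴹ (src Rₗ ∘ arr U) (src Rₗ ∘ arr V)
          q₁ = composable U° π₁ᴹ
          q₂ = composable V° π₂ᴹ
          s = trans (src∘comp {X = Rₗ} _ _ q₁) (trans (arr-src π₁ᴹ)
                (sym (trans (src∘comp {X = Rₗ} _ _ q₂) (arr-src π₂ᴹ))))

    ⟨⟩ᴹ-⊙ : {a b c : Hom J (Ob₀ Rₗ)} (U : Mor Rₗ a b) (V : Mor Rₗ a c) (r : Hom J' J) →
            ⟨ U , V ⟩ᴹ ⊙ r ≈ ⟨ U ⊙ r , V ⊙ r ⟩ᴹ
    ⟨⟩ᴹ-⊙ U V r = ≡⇒≈ (trans (cong (_∘ r) (⟨⟩ᴹ-arr′ refl refl q))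
      (trans (assoc _ _ _) (trans (cong (ppair P l ∘_) (pair-∘ q r q')) (sym (⟨⟩ᴹ-arr′ refl refl q')))))
      where
        q = trans (arr-src U) (sym (arr-src V))
        q' = trans (arr-src (U ⊙ r)) (sym (arr-src (V ⊙ r)))

    ×ᴹ-⊙ : {a b c d : Hom J (Ob₀ Rₗ)} (U : Mor Rₗ a b) (V : Mor Rₗ c d) (r : Hom J' J) →
           (U ×ᴹ V) ⊙ r ≈ (U ⊙ r) ×ᴹ (V ⊙ r)
    ×ᴹ-⊙ {a = a} {c = c} U V r = ≈-trans (⟨⟩ᴹ-⊙ _ _ r) (⟨⟩ᴹ-resp-≈
      (≈-trans (⊙-distrib-⊚ U _ r) (⊚-resp-≈ ≈-refl (fstᴹ-⊙ a c r)))
      (≈-trans (⊙-distrib-⊚ V _ r) (⊚-resp-≈ ≈-refl (sndᴹ-⊙ a c r))))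

  module _ {p : ℕ∞} (Rel : CubicalCat p) (n : ℕ) {l : Lvl p} {Y : ICat} where
    private
      Dom : ICat
      Dom = Disc Rel n l

    F₁≡idn∘F₀ : (F : IFunctor Dom Y) → F₁ F ≡ idn Y ∘ F₀ F
    F₁≡idn∘F₀ F = trans (sym (idʳ _)) (IsIFunctor.F-idn (isIFunctor F))

    discrete : Hom (Ob₀ Dom) (Ob₀ Y) → IFunctor Dom Y
    discrete A = record
      { F₀ = A
      ; F₁ = idn Y ∘ A
      ; isIFunctor = record
        { F-src = trans (src∘idn {X = Y} A) (sym (idʳ A))
        ; F-tgt = trans (tgt∘idn {X = Y} A) (sym (idʳ A))
        ; F-idn = idʳ _
        ; F-comp = λ g f q q' → trans (cong ((idn Y ∘ A) ∘_) (p₁∘pair g f q))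
                                      (idn∘A-comp g f (trans (sym (idˡ g)) (trans q (idˡ f))) q')
        }
      }
      where
        idn∘A-comp : ∀ {J} (g f : Hom J (Ob₀ Dom)) → g ≡ f →
                     (q : src Y ∘ ((idn Y ∘ A) ∘ g) ≡ tgt Y ∘ ((idn Y ∘ A) ∘ f)) →
                     (idn Y ∘ A) ∘ g ≡ comp Y ∘ pair ((idn Y ∘ A) ∘ g) ((idn Y ∘ A) ∘ f) q
        idn∘A-comp g .g refl q = sym (trans (cong (comp Y ∘_) (pair-cong (assoc (idn Y) A g) (assoc (idn Y) A g)))
                                            (trans (comp∘idn-idn {X = Y} (A ∘ g) q′) (sym (assoc (idn Y) A g))))
          where q′ = trans (src∘idn {X = Y} (A ∘ g)) (sym (tgt∘idn {X = Y} (A ∘ g)))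

    -- Naturality is automatic on a discrete domain.
    discreteNat : {F₀′ G₀′ : Hom (Ob₀ Dom) (Ob₀ Y)} {F₁′ G₁′ : Hom (Ob₁ Dom) (Ob₁ Y)} (E : Mor Y F₀′ G₀′) →
                  F₁′ ≡ idn Y ∘ F₀′ → G₁′ ≡ idn Y ∘ G₀′ → INatTrans Dom Y F₀′ F₁′ G₀′ G₁′
    discreteNat {F₀′} {G₀′} E eF eG = record
      { η = arr E
      ; η-src = arr-src E
      ; η-tgt = arr-tgt E
      ; η-natural = λ q q' → begin
          comp Y ∘ pair (arr E ∘ id) _ q      ≡˘⟨ ⊚-arr′ (sym (idʳ (arr E))) (sym eF) q ⟩
          arr (E ⊚ idM F₀′)                   ≡⟨ ≈⇒≡ (⊚-identityʳ E) ⟩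
          arr E                               ≡˘⟨ ≈⇒≡ (⊚-identityˡ E) ⟩
          arr (idM G₀′ ⊚ E)                   ≡⟨ ⊚-arr′ (sym eG) (sym (idʳ (arr E))) q' ⟩
          comp Y ∘ pair _ (arr E ∘ id) q' ∎
      }
      where open ≡-Reasoning

  module FunctorProducts {p : ℕ∞} {m : Level} (Rel : CubicalCat p) (𝓜 : GoodIsos Rel m)
                         (P : HasProducts Rel 𝓜) (SF : StableUnderFaces P) (SD : StableUnderDegeneracies P)
                         (n : ℕ) where
    open Products P

    private
      R : Lvl p → ICat
      R = obj Rel

      Fun : Set (o ⊔ ℓ ⊔ m)
      Fun = FObj Rel 𝓜 n

      _⇒_ : Fun → Fun → Set (o ⊔ ℓ)
      𝔽 ⇒ 𝔾 = FHom Rel 𝓜 n 𝔽 𝔾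

    ob : Fun → (l : Lvl p) → Hom (Ob₀ (R l) ^ n) (Ob₀ (R l))
    ob 𝔽 l = F₀ (𝓕 𝔽 l)

    Components : Fun → Fun → Set ℓ
    Components 𝔽 𝔾 = (l : Lvl p) → Mor (R l) (ob 𝔽 l) (ob 𝔾 l)

    component : {𝔽 𝔾 : Fun} → 𝔽 ⇒ 𝔾 → Components 𝔽 𝔾
    component f l = mor (η (ηc f l)) (η-src (ηc f l)) (η-tgt (ηc f l))

    module Face (⋆ : Bool) (l : ℕ) (k : Fin (suc l)) .(b : suc l ≤∞ p) where
      a c : Lvl p
      a = mkL (suc l) b
      c = mkL l (≤∞-pred b)

      H : IFunctor (R a) (R c)
      H = act Rel (face ⋆ l k b)

      H₀ : Hom (Ob₀ (R a)) (Ob₀ (R c))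
      H₀ = F₀ H

      ×₀-face : (A B : Hom J (Ob₀ (R a))) → H₀ ∘ (A ×₀ B) ≡ (H₀ ∘ A) ×₀ (H₀ ∘ B)
      ×₀-face A B = proj₁ (SF ⋆ l k b A B)

      fstᴹ-face : (A B : Hom J (Ob₀ (R a))) → map H (fstᴹ A B) ≈ fstᴹ (H₀ ∘ A) (H₀ ∘ B)
      fstᴹ-face A B = ≡⇒≈ (proj₁ (proj₂ (SF ⋆ l k b A B)))

      sndᴹ-face : (A B : Hom J (Ob₀ (R a))) → map H (sndᴹ A B) ≈ sndᴹ (H₀ ∘ A) (H₀ ∘ B)
      sndᴹ-face A B = ≡⇒≈ (proj₂ (proj₂ (SF ⋆ l k b A B)))

      ⟨⟩ᴹ-face : {x y z : Hom J (Ob₀ (R a))} (U : Mor (R a) x y) (V : Mor (R a) x z) →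
                 map H ⟨ U , V ⟩ᴹ ≈ ⟨ map H U , map H V ⟩ᴹ
      ⟨⟩ᴹ-face {y = y} {z} U V = ≈-trans (≡⇒≈ refl) (⟨⟩ᴹ-unique {K = cast refl (×₀-face y z) (map H ⟨ U , V ⟩ᴹ)}
        (≈-trans (⊚-resp-≈ (≈-sym (fstᴹ-face y z)) (≡⇒≈ refl)) (map-⊚≈ H (fstᴹ∘⟨⟩ᴹ U V)))
        (≈-trans (⊚-resp-≈ (≈-sym (sndᴹ-face y z)) (≡⇒≈ refl)) (map-⊚≈ H (sndᴹ∘⟨⟩ᴹ U V))))

      ob-face : (𝔽 : Fun) → H₀ ∘ ob 𝔽 a ≡ ob 𝔽 c ∘ pow n H₀
      ob-face 𝔽 = proj₁ (face-pres 𝔽 ⋆ l k b)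

      ×₀-ob-face : (𝔽 𝔾 : Fun) → H₀ ∘ (ob 𝔽 a ×₀ ob 𝔾 a) ≡ (ob 𝔽 c ×₀ ob 𝔾 c) ∘ pow n H₀
      ×₀-ob-face 𝔽 𝔾 = trans (×₀-face _ _) (trans (cong₂ _×₀_ (ob-face 𝔽) (ob-face 𝔾)) (sym (×₀-∘ _ _ _)))

      Natural : {𝔽 𝔾 : Fun} → Components 𝔽 𝔾 → Set ℓ
      Natural Φ = map H (Φ a) ≈ Φ c ⊙ pow n H₀

      natural : {𝔽 𝔾 : Fun} (f : 𝔽 ⇒ 𝔾) → Natural {𝔽} {𝔾} (component f)
      natural f = ≡⇒≈ (ηc-face f ⋆ l k b)

    module Degeneracy (l : ℕ) (k : Fin (suc l)) .(b : suc l ≤∞ p) where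
      a c : Lvl p
      a = mkL l (≤∞-pred b)
      c = mkL (suc l) b

      H : IFunctor (R a) (R c)
      H = act Rel (degen l k b)

      H₀ : Hom (Ob₀ (R a)) (Ob₀ (R c))
      H₀ = F₀ H

      private
        module D = DegenIso (SD l k b)

        ε : Mor (R c) (H₀ ∘ prod P a) (prod P c ∘ (H₀ ×₁ H₀))
        ε = mor D.ε D.ε-src D.ε-tgt

      εᴹ : (A B : Hom J (Ob₀ (R a))) → Mor (R c) (H₀ ∘ (A ×₀ B)) ((H₀ ∘ A) ×₀ (H₀ ∘ B))
      εᴹ A B = cast (assoc _ _ _) (pullʳ (×₁∘⟨⟩ H₀ H₀ A B)) (ε ⊙ ⟨ A , B ⟩)

      fstᴹ∘εᴹ : (A B : Hom J (Ob₀ (R a))) → fstᴹ (H₀ ∘ A) (H₀ ∘ B) ⊚ εᴹ A B ≈ map H (fstᴹ A B)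
      fstᴹ∘εᴹ A B = begin
        fstᴹ (H₀ ∘ A) (H₀ ∘ B) ⊚ εᴹ A B
          ≈⟨ ⊚-resp-≈ (≡⇒≈ (sym (pullʳ (×₁∘⟨⟩ H₀ H₀ A B)))) (≡⇒≈ refl) ⟩
        (fstᴹ (H₀ ∘ π₁) (H₀ ∘ π₂) ⊙ ⟨ A , B ⟩) ⊚ (ε ⊙ ⟨ A , B ⟩)
          ≈˘⟨ ⊙-distrib-⊚ _ ε ⟨ A , B ⟩ ⟩
        (fstᴹ (H₀ ∘ π₁) (H₀ ∘ π₂) ⊚ ε) ⊙ ⟨ A , B ⟩
          ≈⟨ ≡⇒≈ (trans (cong (_∘ ⟨ A , B ⟩) (trans (⊚-arr _ ε q) (D.ε-fst q))) (assoc _ _ _)) ⟩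
        map H (fstᴹ A B) ∎
        where
          open ≈-Reasoning
          q = composable (fstᴹ (H₀ ∘ π₁) (H₀ ∘ π₂)) ε

      sndᴹ∘εᴹ : (A B : Hom J (Ob₀ (R a))) → sndᴹ (H₀ ∘ A) (H₀ ∘ B) ⊚ εᴹ A B ≈ map H (sndᴹ A B)
      sndᴹ∘εᴹ A B = begin
        sndᴹ (H₀ ∘ A) (H₀ ∘ B) ⊚ εᴹ A B
          ≈⟨ ⊚-resp-≈ (≡⇒≈ (sym (pullʳ (×₁∘⟨⟩ H₀ H₀ A B)))) (≡⇒≈ refl) ⟩
        (sndᴹ (H₀ ∘ π₁) (H₀ ∘ π₂) ⊙ ⟨ A , B ⟩) ⊚ (ε ⊙ ⟨ A , B ⟩)
          ≈˘⟨ ⊙-distrib-⊚ _ ε ⟨ A , B ⟩ ⟩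
        (sndᴹ (H₀ ∘ π₁) (H₀ ∘ π₂) ⊚ ε) ⊙ ⟨ A , B ⟩
          ≈⟨ ≡⇒≈ (trans (cong (_∘ ⟨ A , B ⟩) (trans (⊚-arr _ ε q) (D.ε-snd q))) (assoc _ _ _)) ⟩
        map H (sndᴹ A B) ∎
        where
          open ≈-Reasoning
          q = composable (sndᴹ (H₀ ∘ π₁) (H₀ ∘ π₂)) ε

      ε-ob : (𝔽 : Fun) → Mor (R c) (H₀ ∘ ob 𝔽 a) (ob 𝔽 c ∘ pow n H₀)
      ε-ob 𝔽 = mor (η (εF 𝔽 l k b)) (η-src (εF 𝔽 l k b)) (η-tgt (εF 𝔽 l k b))

      ε-⊗ : (𝔽 𝔾 : Fun) → Mor (R c) (H₀ ∘ (ob 𝔽 a ×₀ ob 𝔾 a)) ((ob 𝔽 c ∘ pow n H₀) ×₀ (ob 𝔾 c ∘ pow n H₀))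
      ε-⊗ 𝔽 𝔾 = (ε-ob 𝔽 ×ᴹ ε-ob 𝔾) ⊚ εᴹ (ob 𝔽 a) (ob 𝔾 a)

      ε-⊗-M : (𝔽 𝔾 : Fun) → M 𝓜 c (arr (ε-⊗ 𝔽 𝔾))
      ε-⊗-M 𝔽 𝔾 = ⊚-M _ _ (×ᴹ-M _ _ (εF-M 𝔽 l k b) (εF-M 𝔾 l k b)) (M-reindex 𝓜 c _ _ D.ε-M)

      fstᴹ∘ε-⊗ : (𝔽 𝔾 : Fun) → fstᴹ _ _ ⊚ ε-⊗ 𝔽 𝔾 ≈ ε-ob 𝔽 ⊚ map H (fstᴹ (ob 𝔽 a) (ob 𝔾 a))
      fstᴹ∘ε-⊗ 𝔽 𝔾 = begin
        fstᴹ _ _ ⊚ ((ε-ob 𝔽 ×ᴹ ε-ob 𝔾) ⊚ εᴹ _ _)    ≈˘⟨ ⊚-assoc _ _ _ ⟩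
        (fstᴹ _ _ ⊚ (ε-ob 𝔽 ×ᴹ ε-ob 𝔾)) ⊚ εᴹ _ _    ≈⟨ ⊚-resp-≈ (fstᴹ∘×ᴹ _ _) ≈-refl ⟩
        (ε-ob 𝔽 ⊚ fstᴹ _ _) ⊚ εᴹ _ _                ≈⟨ ⊚-assoc _ _ _ ⟩
        ε-ob 𝔽 ⊚ (fstᴹ _ _ ⊚ εᴹ _ _)                ≈⟨ ⊚-resp-≈ ≈-refl (fstᴹ∘εᴹ _ _) ⟩
        ε-ob 𝔽 ⊚ map H (fstᴹ _ _) ∎
        where open ≈-Reasoning

      sndᴹ∘ε-⊗ : (𝔽 𝔾 : Fun) → sndᴹ _ _ ⊚ ε-⊗ 𝔽 𝔾 ≈ ε-ob 𝔾 ⊚ map H (sndᴹ (ob 𝔽 a) (ob 𝔾 a))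
      sndᴹ∘ε-⊗ 𝔽 𝔾 = begin
        sndᴹ _ _ ⊚ ((ε-ob 𝔽 ×ᴹ ε-ob 𝔾) ⊚ εᴹ _ _)    ≈˘⟨ ⊚-assoc _ _ _ ⟩
        (sndᴹ _ _ ⊚ (ε-ob 𝔽 ×ᴹ ε-ob 𝔾)) ⊚ εᴹ _ _    ≈⟨ ⊚-resp-≈ (sndᴹ∘×ᴹ _ _) ≈-refl ⟩
        (ε-ob 𝔾 ⊚ sndᴹ _ _) ⊚ εᴹ _ _                ≈⟨ ⊚-assoc _ _ _ ⟩
        ε-ob 𝔾 ⊚ (sndᴹ _ _ ⊚ εᴹ _ _)                ≈⟨ ⊚-resp-≈ ≈-refl (sndᴹ∘εᴹ _ _) ⟩
        ε-ob 𝔾 ⊚ map H (sndᴹ _ _) ∎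
        where open ≈-Reasoning

      Natural : {𝔽 𝔾 : Fun} → Components 𝔽 𝔾 → Set ℓ
      Natural {𝔽} {𝔾} Φ = (Φ c ⊙ pow n H₀) ⊚ ε-ob 𝔽 ≈ ε-ob 𝔾 ⊚ map H (Φ a)

      natural : {𝔽 𝔾 : Fun} (f : 𝔽 ⇒ 𝔾) → Natural {𝔽} {𝔾} (component f)
      natural {𝔽} {𝔾} f = ≡⇒≈ (trans (⊚-arr _ _ q) (trans (ηc-degen f l k b q q') (sym (⊚-arr _ _ q'))))
        where
          q = composable (component f c ⊙ pow n H₀) (ε-ob 𝔽)
          q' = composable (ε-ob 𝔾) (map H (component f a))

      ⟨⟩ᴹ-natural : {ℍ 𝔽 𝔾 : Fun} (Φ : Components ℍ 𝔽) (Ψ : Components ℍ 𝔾) →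
                    Natural {ℍ} {𝔽} Φ → Natural {ℍ} {𝔾} Ψ →
                    (⟨ Φ c , Ψ c ⟩ᴹ ⊙ pow n H₀) ⊚ ε-ob ℍ ≈ ε-⊗ 𝔽 𝔾 ⊚ map H ⟨ Φ a , Ψ a ⟩ᴹ
      ⟨⟩ᴹ-natural {ℍ} {𝔽} {𝔾} Φ Ψ natΦ natΨ = begin
        (⟨ Φ c , Ψ c ⟩ᴹ ⊙ pow n H₀) ⊚ ε-ob ℍ                     ≈⟨ ⊚-resp-≈ (⟨⟩ᴹ-⊙ _ _ _) ≈-refl ⟩
        ⟨ Φ c ⊙ pow n H₀ , Ψ c ⊙ pow n H₀ ⟩ᴹ ⊚ ε-ob ℍ            ≈⟨ ⟨⟩ᴹ-∘ _ _ _ ⟩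
        ⟨ (Φ c ⊙ pow n H₀) ⊚ ε-ob ℍ , (Ψ c ⊙ pow n H₀) ⊚ ε-ob ℍ ⟩ᴹ ≈⟨ ⟨⟩ᴹ-resp-≈ natΦ natΨ ⟩
        ⟨ ε-ob 𝔽 ⊚ map H (Φ a) , ε-ob 𝔾 ⊚ map H (Ψ a) ⟩ᴹ          ≈˘⟨ ⟨⟩ᴹ-unique (projects (fstᴹ∘ε-⊗ 𝔽 𝔾) (fstᴹ∘⟨⟩ᴹ _ _))
                                                                                (projects (sndᴹ∘ε-⊗ 𝔽 𝔾) (sndᴹ∘⟨⟩ᴹ _ _)) ⟩
        ε-⊗ 𝔽 𝔾 ⊚ map H ⟨ Φ a , Ψ a ⟩ᴹ ∎
        where
          open ≈-Reasoning
          projects : ∀ {x y} {π : Mor (R c) _ x} {πₐ : Mor (R a) _ y} {ε′ : Mor (R c) (H₀ ∘ y) x} {Θ : Mor (R a) (ob ℍ a) y} →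
                     π ⊚ ε-⊗ 𝔽 𝔾 ≈ ε′ ⊚ map H πₐ → πₐ ⊚ ⟨ Φ a , Ψ a ⟩ᴹ ≈ Θ →
                     π ⊚ (ε-⊗ 𝔽 𝔾 ⊚ map H ⟨ Φ a , Ψ a ⟩ᴹ) ≈ ε′ ⊚ map H Θ
          projects e e' = ≈-trans (≈-sym (⊚-assoc _ _ _))
                            (≈-trans (⊚-resp-≈ e ≈-refl) (≈-trans (⊚-assoc _ _ _) (⊚-resp-≈ ≈-refl (map-⊚≈ H e'))))

    module _ (𝔽 : Fun) (l : Lvl p) (m' : ℕ) where
      υᴹ : (f : Hom (Ob₀ (R l) ^ m') (Ob₁ (R l) ^ n)) .(pf : ∀ (k : Fin n) → M 𝓜 l (proj k ∘ f)) →
           Mor (R l) (ob 𝔽 l ∘ (pow n (src (R l)) ∘ f)) (ob 𝔽 l ∘ (pow n (tgt (R l)) ∘ f))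
      υᴹ f pf = mor (υ 𝔽 l m' f pf) (υ-src 𝔽 l m' f pf) (υ-tgt 𝔽 l m' f pf)

      υᴹ-idM : (x : Hom (Ob₀ (R l) ^ m') (Ob₀ (R l) ^ n))
               .(pf : ∀ (k : Fin n) → M 𝓜 l (proj k ∘ (pow n (idn (R l)) ∘ x))) →
               υᴹ (pow n (idn (R l)) ∘ x) pf ≈ idM (ob 𝔽 l ∘ x)
      υᴹ-idM x pf = ≡⇒≈ (trans (υ-id 𝔽 l m' x pf) (trans (cong (_∘ x) (F₁≡idn∘F₀ Rel n (𝓕 𝔽 l))) (assoc _ _ _)))

      υᴹ-comp : (g f : Hom (Ob₀ (R l) ^ m') (Ob₁ (R l) ^ n))
                (ck : ∀ (k : Fin n) → src (R l) ∘ (proj k ∘ g) ≡ tgt (R l) ∘ (proj k ∘ f))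
                .(pg : ∀ (k : Fin n) → M 𝓜 l (proj k ∘ g))
                .(pf : ∀ (k : Fin n) → M 𝓜 l (proj k ∘ f))
                .(pgf : ∀ (k : Fin n) → M 𝓜 l (proj k ∘ tuple n (λ k → comp (R l) ∘ pair (proj k ∘ g) (proj k ∘ f) (ck k)))) →
                υᴹ (tuple n (λ k → comp (R l) ∘ pair (proj k ∘ g) (proj k ∘ f) (ck k))) pgf
                ≈ υᴹ g pg ⊚ cast refl (cong (ob 𝔽 l ∘_) (sym (pow∘-ext n ck))) (υᴹ f pf)
      υᴹ-comp g f ck pg pf pgf = ≡⇒≈ (trans (υ-comp 𝔽 l m' g f ck pg pf pgf q) (sym (⊚-arr _ _ q)))
        where q = composable (υᴹ g pg) (cast refl (cong (ob 𝔽 l ∘_) (sym (pow∘-ext n ck))) (υᴹ f pf))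

    υᴹ-reindex : (𝔽 : Fun) (l : Lvl p) (m' m'' : ℕ) (f : Hom (Ob₀ (R l) ^ m') (Ob₁ (R l) ^ n))
                 (r : Hom (Ob₀ (R l) ^ m'') (Ob₀ (R l) ^ m'))
                 .(pf : ∀ (k : Fin n) → M 𝓜 l (proj k ∘ f)) .(pfr : ∀ (k : Fin n) → M 𝓜 l (proj k ∘ (f ∘ r))) →
                 υᴹ 𝔽 l m'' (f ∘ r) pfr ≈ υᴹ 𝔽 l m' f pf ⊙ r
    υᴹ-reindex 𝔽 l m' m'' f r pf pfr = ≡⇒≈ (υ-reindex 𝔽 l m' m'' f r pf pfr)

    module Product (𝔽 𝔾 : Fun) where
      ob⊗ : (l : Lvl p) → Hom (Ob₀ (R l) ^ n) (Ob₀ (R l))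
      ob⊗ l = ob 𝔽 l ×₀ ob 𝔾 l

      module _ (l : Lvl p) (m' : ℕ) where
        υᴹ⊗ : (f : Hom (Ob₀ (R l) ^ m') (Ob₁ (R l) ^ n)) .(pf : ∀ (k : Fin n) → M 𝓜 l (proj k ∘ f)) →
              Mor (R l) ((ob 𝔽 l ∘ (pow n (src (R l)) ∘ f)) ×₀ (ob 𝔾 l ∘ (pow n (src (R l)) ∘ f)))
                        ((ob 𝔽 l ∘ (pow n (tgt (R l)) ∘ f)) ×₀ (ob 𝔾 l ∘ (pow n (tgt (R l)) ∘ f)))
        υᴹ⊗ f pf = υᴹ 𝔽 l m' f pf ×ᴹ υᴹ 𝔾 l m' f pf

        υ⊗-id : (x : Hom (Ob₀ (R l) ^ m') (Ob₀ (R l) ^ n))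
                .(pf : ∀ (k : Fin n) → M 𝓜 l (proj k ∘ (pow n (idn (R l)) ∘ x))) →
                arr (υᴹ⊗ (pow n (idn (R l)) ∘ x) pf) ≡ (idn (R l) ∘ ob⊗ l) ∘ x
        υ⊗-id x pf = trans (≈⇒≡ (×ᴹ-idM (υᴹ-idM 𝔽 l m' x pf) (υᴹ-idM 𝔾 l m' x pf)))
                           (trans (cong (idn (R l) ∘_) (sym (×₀-∘ _ _ x))) (sym (assoc _ _ _)))

        υ⊗-comp : (g f : Hom (Ob₀ (R l) ^ m') (Ob₁ (R l) ^ n))
                  (ck : ∀ (k : Fin n) → src (R l) ∘ (proj k ∘ g) ≡ tgt (R l) ∘ (proj k ∘ f))
                  .(pg : ∀ (k : Fin n) → M 𝓜 l (proj k ∘ g))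
                  .(pf : ∀ (k : Fin n) → M 𝓜 l (proj k ∘ f))
                  .(pgf : ∀ (k : Fin n) → M 𝓜 l (proj k ∘ tuple n (λ k → comp (R l) ∘ pair (proj k ∘ g) (proj k ∘ f) (ck k))))
                  (q : src (R l) ∘ arr (υᴹ⊗ g pg) ≡ tgt (R l) ∘ arr (υᴹ⊗ f pf)) →
                  arr (υᴹ⊗ (tuple n (λ k → comp (R l) ∘ pair (proj k ∘ g) (proj k ∘ f) (ck k))) pgf)
                  ≡ comp (R l) ∘ pair (arr (υᴹ⊗ g pg)) (arr (υᴹ⊗ f pf)) q
        υ⊗-comp g f ck pg pf pgf q =
          trans (≈⇒≡ (≈-trans (×ᴹ-resp-≈ (υᴹ-comp 𝔽 l m' g f ck pg pf pgf) (υᴹ-comp 𝔾 l m' g f ck pg pf pgf))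
                               (×ᴹ-interchange _ _ _ _)))
                (⊚-arr′ refl (≈⇒≡ (×ᴹ-resp-≈ (≡⇒≈ refl) (≡⇒≈ refl))) q)

      υ⊗-reindex : ∀ l m' m'' (f : Hom (Ob₀ (R l) ^ m') (Ob₁ (R l) ^ n)) (r : Hom (Ob₀ (R l) ^ m'') (Ob₀ (R l) ^ m'))
                   .(pf : ∀ (k : Fin n) → M 𝓜 l (proj k ∘ f)) .(pfr : ∀ (k : Fin n) → M 𝓜 l (proj k ∘ (f ∘ r))) →
                   arr (υᴹ⊗ l m'' (f ∘ r) pfr) ≡ arr (υᴹ⊗ l m' f pf) ∘ r
      υ⊗-reindex l m' m'' f r pf pfr = ≈⇒≡ (≈-trans (×ᴹ-resp-≈ (υᴹ-reindex 𝔽 l m' m'' f r pf pfr) (υᴹ-reindex 𝔾 l m' m'' f r pf pfr))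
                                                   (≈-sym (×ᴹ-⊙ _ _ r)))

      product : Fun
      product = record
        { 𝓕 = λ l → discrete Rel n (ob⊗ l)
        ; face-pres = λ ⋆ l k b → let open Face ⋆ l k b in
            ×₀-ob-face 𝔽 𝔾 ,
            trans (≈⇒≡ (map-idM H _)) (trans (cong (idn (R c) ∘_) (×₀-ob-face 𝔽 𝔾)) (sym (assoc _ _ _)))
        ; εF = λ l k b → let open Degeneracy l k b in
            discreteNat Rel n (cast refl (sym (×₀-∘ _ _ _)) (ε-⊗ 𝔽 𝔾)) (≈⇒≡ (map-idM H _)) (assoc _ _ _)
        ; εF-M = λ l k b → Degeneracy.ε-⊗-M l k b 𝔽 𝔾
        ; υ = λ l m' f pf → arr (υᴹ⊗ l m' f pf)
        ; υ-M = λ l m' f pf → ×ᴹ-M _ _ (υ-M 𝔽 l m' f pf) (υ-M 𝔾 l m' f pf)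
        ; υ-src = λ l m' f pf → trans (arr-src (υᴹ⊗ l m' f pf)) (sym (×₀-∘ _ _ _))
        ; υ-tgt = λ l m' f pf → trans (arr-tgt (υᴹ⊗ l m' f pf)) (sym (×₀-∘ _ _ _))
        ; υ-id = υ⊗-id
        ; υ-comp = υ⊗-comp
        ; υ-reindex = υ⊗-reindex
        }

    fromComponents : {𝔽 𝔾 : Fun} (Φ : Components 𝔽 𝔾) →
                     ((⋆ : Bool) (l : ℕ) (k : Fin (suc l)) .(b : suc l ≤∞ p) → Face.Natural ⋆ l k b {𝔽} {𝔾} Φ) →
                     ((l : ℕ) (k : Fin (suc l)) .(b : suc l ≤∞ p) → Degeneracy.Natural l k b {𝔽} {𝔾} Φ) →
                     𝔽 ⇒ 𝔾
    fromComponents {𝔽} {𝔾} Φ face-natural degen-natural = record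
      { ηc = λ l → discreteNat Rel n (Φ l) (F₁≡idn∘F₀ Rel n (𝓕 𝔽 l)) (F₁≡idn∘F₀ Rel n (𝓕 𝔾 l))
      ; ηc-face = λ ⋆ l k b → ≈⇒≡ (face-natural ⋆ l k b)
      ; ηc-degen = λ l k b q q' → trans (sym (⊚-arr _ _ q)) (trans (≈⇒≡ (degen-natural l k b)) (⊚-arr _ _ q'))
      }

    _⊗_ : Fun → Fun → Fun
    _⊗_ = Product.product

    fstF : {𝔽 𝔾 : Fun} → (𝔽 ⊗ 𝔾) ⇒ 𝔽
    fstF {𝔽} {𝔾} = fromComponents (λ l → fstᴹ (ob 𝔽 l) (ob 𝔾 l))
      (λ ⋆ l k b → let open Face ⋆ l k b in
        ≈-trans (fstᴹ-face _ _) (≈-trans (fstᴹ-cong (ob-face 𝔽) (ob-face 𝔾)) (≈-sym (fstᴹ-⊙ _ _ _))))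
      (λ l k b → let open Degeneracy l k b in ≈-trans (⊚-resp-≈ (fstᴹ-⊙ _ _ _) (≡⇒≈ refl)) (fstᴹ∘ε-⊗ 𝔽 𝔾))

    sndF : {𝔽 𝔾 : Fun} → (𝔽 ⊗ 𝔾) ⇒ 𝔾
    sndF {𝔽} {𝔾} = fromComponents (λ l → sndᴹ (ob 𝔽 l) (ob 𝔾 l))
      (λ ⋆ l k b → let open Face ⋆ l k b in
        ≈-trans (sndᴹ-face _ _) (≈-trans (sndᴹ-cong (ob-face 𝔽) (ob-face 𝔾)) (≈-sym (sndᴹ-⊙ _ _ _))))
      (λ l k b → let open Degeneracy l k b in ≈-trans (⊚-resp-≈ (sndᴹ-⊙ _ _ _) (≡⇒≈ refl)) (sndᴹ∘ε-⊗ 𝔽 𝔾))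

    ⟪_,_⟫ : {ℍ 𝔽 𝔾 : Fun} → ℍ ⇒ 𝔽 → ℍ ⇒ 𝔾 → ℍ ⇒ (𝔽 ⊗ 𝔾)
    ⟪_,_⟫ {ℍ} {𝔽} {𝔾} f g = fromComponents (λ l → ⟨ component f l , component g l ⟩ᴹ)
      (λ ⋆ l k b → let open Face ⋆ l k b in
        ≈-trans (⟨⟩ᴹ-face (component f a) (component g a))
                (≈-trans (⟨⟩ᴹ-resp-≈ (natural f) (natural g)) (≈-sym (⟨⟩ᴹ-⊙ (component f c) (component g c) (pow n H₀)))))
      (λ l k b → let open Degeneracy l k b in
        ≈-trans (⟨⟩ᴹ-natural {ℍ} {𝔽} {𝔾} (component f) (component g) (natural f) (natural g))
                (⊚-resp-≈ {G = ε-⊗ 𝔽 𝔾} {G' = ε-ob (𝔽 ⊗ 𝔾)} (≡⇒≈ refl) ≈-refl))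

    fst∘⟪⟫ : {ℍ 𝔽 𝔾 : Fun} (f : ℍ ⇒ 𝔽) (g : ℍ ⇒ 𝔾) → _≈F_ Rel 𝓜 n (compC Rel 𝓜 n (fstF {𝔽} {𝔾}) ⟪ f , g ⟫) f
    fst∘⟪⟫ {_} {𝔽} {𝔾} f g l =
      trans (sym (⊚-arr (fstᴹ (ob 𝔽 l) (ob 𝔾 l)) ⟨ component f l , component g l ⟩ᴹ _))
            (≈⇒≡ (fstᴹ∘⟨⟩ᴹ (component f l) (component g l)))

    snd∘⟪⟫ : {ℍ 𝔽 𝔾 : Fun} (f : ℍ ⇒ 𝔽) (g : ℍ ⇒ 𝔾) → _≈F_ Rel 𝓜 n (compC Rel 𝓜 n (sndF {𝔽} {𝔾}) ⟪ f , g ⟫) g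
    snd∘⟪⟫ {_} {𝔽} {𝔾} f g l =
      trans (sym (⊚-arr (sndᴹ (ob 𝔽 l) (ob 𝔾 l)) ⟨ component f l , component g l ⟩ᴹ _))
            (≈⇒≡ (sndᴹ∘⟨⟩ᴹ (component f l) (component g l)))

    ⟪⟫-unique : {ℍ 𝔽 𝔾 : Fun} (f : ℍ ⇒ 𝔽) (g : ℍ ⇒ 𝔾) (h : ℍ ⇒ (𝔽 ⊗ 𝔾)) →
                _≈F_ Rel 𝓜 n (compC Rel 𝓜 n (fstF {𝔽} {𝔾}) h) f → _≈F_ Rel 𝓜 n (compC Rel 𝓜 n (sndF {𝔽} {𝔾}) h) g →
                _≈F_ Rel 𝓜 n (λ l → η (ηc h l)) ⟪ f , g ⟫
    ⟪⟫-unique {_} {𝔽} {𝔾} f g h hf hg l = ≈⇒≡ (⟨⟩ᴹ-unique {U = component f l} {V = component g l}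
      (≡⇒≈ (trans (⊚-arr (fstᴹ (ob 𝔽 l) (ob 𝔾 l)) (component h l) _) (hf l)))
      (≡⇒≈ (trans (⊚-arr (sndᴹ (ob 𝔽 l) (ob 𝔾 l)) (component h l) _) (hg l))))

    binaryProducts : BinaryProducts Rel 𝓜 n
    -- The implicit arguments are passed on explicitly: inferring them would unfold 𝔽 ⊗ 𝔾.
    binaryProducts = record
      { _⊗_ = _⊗_
      ; fstF = λ {𝔽} {𝔾} → fstF {𝔽} {𝔾}
      ; sndF = λ {𝔽} {𝔾} → sndF {𝔽} {𝔾}
      ; ⟪_,_⟫ = λ {ℍ} {𝔽} {𝔾} → ⟪_,_⟫ {ℍ} {𝔽} {𝔾}
      ; fst∘⟪⟫ = λ {ℍ} {𝔽} {𝔾} → fst∘⟪⟫ {ℍ} {𝔽} {𝔾}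
      ; snd∘⟪⟫ = λ {ℍ} {𝔽} {𝔾} → snd∘⟪⟫ {ℍ} {𝔽} {𝔾}
      ; ⟪⟫-unique = λ {ℍ} {𝔽} {𝔾} → ⟪⟫-unique {ℍ} {𝔽} {𝔾}
      }

lemma15 : ∀ {o ℓ m : Level} (𝒞 : FinCompleteCategory o ℓ) (p : ℕ∞)
    (Rel : Internal.CubicalCat 𝒞 p) (𝓜 : Internal.GoodIsos 𝒞 Rel m)
    (P : Internal.HasProducts 𝒞 Rel 𝓜) →
    Internal.StableUnderFaces 𝒞 P →
    Internal.StableUnderDegeneracies 𝒞 P →
    (n : ℕ) → Internal.BinaryProducts 𝒞 Rel 𝓜 n
lemma15 𝒞 p Rel 𝓜 P SF SD n = Construction.FunctorProducts.binaryProducts 𝒞 Rel 𝓜 P SF SD n
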